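{- Let $g\in\mathbb{Q}\setminus\{ -1,0,1\}$, write $g=\pm g_0^h$ with $g_0>0$ not an exact power of a rational number and $h$ as large as possible, and let $d$ be a positive integer. Then $$\sum_{v\mid d^{\infty}}\sum_{\alpha\mid d}{\mu(\alpha)(\alpha v,h)\over \varphi(dv)\,\alpha v}=S(d,h),\qquad\text{where } S(d,h):={1\over d\,(h,d^{\infty})}\prod_{p\mid d}{p^2\over p^2-1}.$$
   Context: $v\mid d^{\infty}$ means $v$ is a positive integer all of whose prime factors divide $d$; $(h,d^{\infty})=\prod_{p\mid d}p^{\nu_p(h)}$; $(a,b)$ is the gcd, $\mu$ the Möbius function, $\varphi$ Euler's totient. -}

module Defs where

open import Data.Bool using (Bool; true; false; _∧_; _∨_; not; if_then_else_)
open import Data.Nat as ℕ using (ℕ; zero; suc; _∸_; _⊔_; _≤_)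
open import Data.Nat.GCD using (gcd)
open import Data.Nat.Divisibility using (_∣?_)
open import Data.Nat.Primality using (prime?)
open import Data.Integer as ℤ using (ℤ; +_)
open import Data.List using (List; []; _∷_; filter; filterᵇ; length; foldr; map; upTo; applyUpTo)
open import Data.Nat.ListAction using (product)
open import Data.Rational as ℚ using (ℚ; 0ℚ; 1ℚ; _/_; _+_; _*_; _-_; ∣_∣; _<_)
open import Data.Product using (∃; _×_)
open import Relation.Nullary using (does)

range1 : ℕ → List ℕ
range1 n = applyUpTo suc n

isPrime : ℕ → Bool
isPrime p = does (prime? p)

divides : ℕ → ℕ → Bool
divides a b = does (a ∣? b)

-- primes dividing n (for n ≥ 1 all such primes lie in [1..n])
primeDivisors : ℕ → List ℕ
primeDivisors n = filterᵇ (λ p → isPrime p ∧ divides p n) (range1 n)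

divisorsOf : ℕ → List ℕ
divisorsOf n = filterᵇ (λ a → divides a n) (range1 n)

μ : ℕ → ℤ
μ n = if squareFree then sign (length (primeDivisors n)) else + 0
  where
  squareFree : Bool
  squareFree = foldr (λ p b → not (divides (p ℕ.* p) n) ∧ b) true (primeDivisors n)
  sign : ℕ → ℤ
  sign zero = + 1
  sign (suc k) = ℤ.- sign k

φ : ℕ → ℕ
φ n = length (filterᵇ (λ k → does (gcd k n ℕ.≟ 1)) (range1 n))

-- v ∣ d^∞ : v is a positive integer all of whose prime factors divide d
-- (every prime factor of v ≥ 1 lies in [1..v], so the check is exhaustive)
divInf : ℕ → ℕ → Bool
divInf d zero = false
divInf d v@(suc _) = foldr (λ p b → (not (isPrime p ∧ divides p v) ∨ divides p d) ∧ b) true (range1 v)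

-- p-adic valuation ν_p(h) for h ≥ 1, p ≥ 2: the largest k ≤ h with p^k ∣ h
ν : ℕ → ℕ → ℕ
ν p h = foldr _⊔_ 0 (filterᵇ (λ k → divides (p ℕ.^ k) h) (range1 h))

-- (h, d^∞) = ∏_{p ∣ d} p^{ν_p(h)}
gcdInf : ℕ → ℕ → ℕ
gcdInf h d = product (map (λ p → p ℕ.^ ν p h) (primeDivisors d))

-- total division of an integer by a natural number (x / 0 := 0; only used
-- with nonzero denominators)
_÷ℕ_ : ℤ → ℕ → ℚ
z ÷ℕ zero = 0ℚ
z ÷ℕ (suc n) = z / suc n

ℚsum : List ℚ → ℚ
ℚsum = foldr _+_ 0ℚ

ℚprod : List ℚ → ℚ
ℚprod = foldr _*_ 1ℚ

_^ℚ_ : ℚ → ℕ → ℚ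
q ^ℚ zero = 1ℚ
q ^ℚ suc k = q * (q ^ℚ k)

inner : ℕ → ℕ → ℕ → ℚ
inner d h v = ℚsum (map (λ α → (μ α ℤ.* + gcd (α ℕ.* v) h) ÷ℕ (φ (d ℕ.* v) ℕ.* α ℕ.* v)) (divisorsOf d))

partialSum : ℕ → ℕ → ℕ → ℚ
partialSum d h N = ℚsum (map (inner d h) (filterᵇ (divInf d) (range1 N)))

-- the series Σ_{v ∣ d^∞} inner(v) (v in increasing order) converges to L
SeriesSumIs : ℕ → ℕ → ℚ → Set
SeriesSumIs d h L = ∀ (ε : ℚ) → 0ℚ < ε → ∃ λ N → ∀ n → N ≤ n → ∣ partialSum d h n - L ∣ < ε

S : ℕ → ℕ → ℚ
S d h = ((+ 1) ÷ℕ (d ℕ.* gcdInf h d)) * ℚprod (map (λ p → (+ (p ℕ.* p)) ÷ℕ (p ℕ.* p ∸ 1)) (primeDivisors d))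

NotPerfectPower : ℚ → Set
NotPerfectPower g₀ = ∀ (r : ℚ) (k : ℕ) → 2 ≤ k → r ^ℚ k ≡ g₀ → ⊥
  where open import Relation.Binary.PropositionalEquality using (_≡_)
        open import Data.Empty using (⊥)

{-# OPTIONS --safe #-}
-- Let Q be the set of primes dividing d and H = (h, d^∞) = ∏_{p ∈ Q} p^ν_p(h). For v ∣ d^∞ the Möbius sum
-- Σ_{α ∣ d} μ(α) (αv, h)/α is expanded one prime at a time. If p (v, h) ∣ h for some p ∈ Q, i.e. ν_p(v) < ν_p(h),
-- the terms for α and pα cancel and the sum vanishes; otherwise (αv, h) = (v, h) = H for every α and the sum is
-- H ∏_{p ∈ Q} (1 - 1/p). Since φ(dv) = dv ∏_{p ∈ Q} (1 - 1/p), the inner term is H/(d v²) if H ∣ v and 0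
-- otherwise, so with v = H w the N-th partial sum is F_Q(⌊N/H⌋)/(dH), where F_Q(M) = Σ 1/w² over the w ≤ M
-- composed of primes in Q. Splitting off the multiples of p gives F_{p∷Q}(M) = F_Q(M) + F_{p∷Q}(⌊M/p⌋)/p², the
-- recursion also satisfied by the Euler product ∏_{p ∈ Q} p²/(p² - 1), and induction on Q bounds the
-- difference by 2^|Q|/(M + 1).
module Submission where

open import Algebra.Bundles using (CommutativeMonoid; CommutativeSemigroup)
open import Algebra.Structures using (IsCommutativeMonoid)
import Algebra.Properties.CommutativeSemigroup as CommutativeSemigroupProperties
open import Data.Bool using (Bool; true; false; _∧_; not; if_then_else_; T)
open import Data.Bool.Properties using (T-∧)
open import Data.Empty using (⊥; ⊥-elim)
open import Data.Integer as ℤ using (ℤ; +_; -[1+_])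
import Data.Integer.Properties as ℤP
open import Data.List using (List; []; _∷_; _++_; length; foldr; map; filterᵇ)
import Data.List.Properties as List
open import Data.List.Membership.Propositional using (_∈_; _∉_; find)
open import Data.List.Membership.Propositional.Properties using (∈-applyUpTo⁺; ∈-filter⁺; ∈-filter⁻)
open import Data.List.Relation.Unary.Any as Any using (Any; here; there)
open import Data.Nat as ℕ using (ℕ; zero; suc; _+_; _*_; _∸_; _^_; _⊔_; _≤_; _<_; z≤n; s≤s; NonZero; _≟_)
open import Data.Nat.Properties
open import Data.List.Membership.DecPropositional _≟_ using (_∈?_)
open import Data.Nat.DivMod using (_/_; _%_; m/n<m; m≡m%n+[m/n]*n; m%n<n; m*n/n≡m; m<n⇒m/n≡0; +-distrib-/-∣ˡ; 0/n≡0)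
open import Data.Nat.Induction using (<-rec)
open import Data.Nat.Tactic.RingSolver using (solve-∀)
open import Data.Nat.Divisibility
  using (_∣_; _∤_; _∣?_; ∣⇒≤; ∣m+n∣m⇒∣n; m∣m*n; n∣m*n; ∣n⇒∣m*n; ∣-trans; ∣-antisym; 1∣_; ∣1⇒≡1; 0∣⇒≡0; *-monoʳ-∣; *-monoˡ-∣; *-cancelˡ-∣)
open import Data.Nat.GCD using (gcd; gcd[m,n]∣m; gcd[m,n]∣n; gcd-greatest; c*gcd[m,n]≡gcd[cm,cn])
open import Data.Nat.Coprimality using (Coprime; coprime-divisor; coprime⇒gcd≡1)
open import Data.Nat.Primality using (Prime; prime?; euclidsLemma; prime⇒irreducible; prime⇒nonZero; prime⇒nonTrivial; ¬prime[1])
open import Data.Nat.Primality.Factorisation using (factorise)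
open import Data.Nat.ListAction using (product)
open import Data.List.Relation.Unary.AllPairs using (AllPairs; []; _∷_)
import Data.List.Relation.Unary.All as All
import Data.List.Relation.Unary.Unique.Propositional.Properties as Unique
open import Data.Product using (∃; _×_; _,_; proj₁; proj₂; uncurry)
open import Data.Rational as ℚ using (ℚ; 0ℚ; 1ℚ; mkℚ)
open import Data.Rational using (-_)
import Data.Rational
import Data.Rational.Properties as ℚP
open import Data.Rational.Unnormalised as ℚᵘ using (mkℚᵘ; *≡*)
import Data.Rational.Unnormalised.Properties as ℚᵘP
open import Data.Sum using (_⊎_; inj₁; inj₂; [_,_]′; reduce)
open import Data.Unit using (tt)
open import Function using (_∘_)
open import Function.Bundles using (Equivalence; mk⇔)
open import Level using (0ℓ)
open import Relation.Binary.PropositionalEquality using (_≡_; _≢_; refl; sym; trans; cong; cong₂; subst; subst₂; module ≡-Reasoning)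
open import Relation.Nullary using (¬_; Dec; yes; no; does)
open import Relation.Nullary.Decidable using (dec-true; dec-false; does-⇔; _×-dec_; _→-dec_)
import Relation.Nullary.Decidable
import Tactic.RingSolver as RingSolver
import Tactic.RingSolver.Core.AlmostCommutativeRing as ACR

open import Defs

T-does⁻¹ : ∀ {P : Set} (P? : Dec P) → T (does P?) → P
T-does⁻¹ (yes p) _ = p

T-does : ∀ {P : Set} (P? : Dec P) → P → T (does P?)
T-does (yes _) _ = tt
T-does (no ¬p) p = ¬p p

T-not-does⁻¹ : ∀ {P : Set} (P? : Dec P) → T (not (does P?)) → ¬ P
T-not-does⁻¹ (no ¬p) _ = ¬p

T-not-does : ∀ {P : Set} (P? : Dec P) → ¬ P → T (not (does P?))
T-not-does (yes p) ¬p = ¬p p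
T-not-does (no _)  _  = tt

T-ext : ∀ {b c : Bool} → (T b → T c) → (T c → T b) → b ≡ c
T-ext {false} {false} _ _ = refl
T-ext {false} {true}  _ g = ⊥-elim (g tt)
T-ext {true}  {false} f _ = ⊥-elim (f tt)
T-ext {true}  {true}  _ _ = refl

T-all⁻ : ∀ (f : ℕ → Bool) xs → T (foldr (λ x b → f x ∧ b) true xs) → ∀ {x} → x ∈ xs → T (f x)
T-all⁻ f (y ∷ xs) t (here refl) = proj₁ (Equivalence.to (T-∧ {f y}) t)
T-all⁻ f (y ∷ xs) t (there x∈) = T-all⁻ f xs (proj₂ (Equivalence.to (T-∧ {f y}) t)) x∈

T-all⁺ : ∀ (f : ℕ → Bool) xs → (∀ {x} → x ∈ xs → T (f x)) → T (foldr (λ x b → f x ∧ b) true xs)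
T-all⁺ f [] _ = tt
T-all⁺ f (y ∷ xs) t = Equivalence.from (T-∧ {f y}) (t (here refl) , T-all⁺ f xs (t ∘ there))

suc-/ : ∀ p .{{_ : NonZero p}} n → suc n ≡ p * suc (n / p) ⊎ (p ∤ suc n × suc n / p ≡ n / p)
suc-/ p n with suc (n % p) ≟ p
... | yes 1+r≡p = inj₁ (begin
  suc n                  ≡⟨ cong suc (m≡m%n+[m/n]*n n p) ⟩
  suc (n % p) + n / p * p ≡⟨ cong₂ _+_ 1+r≡p (*-comm (n / p) p) ⟩
  p + p * (n / p)        ≡⟨ sym (*-suc p (n / p)) ⟩
  p * suc (n / p)        ∎)
  where open ≡-Reasoning
... | no 1+r≢p = inj₂ (p∤1+n , 1+n/p≡n/p)
  where
  1+r<p : suc (n % p) < p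
  1+r<p = ≤∧≢⇒< (m%n<n n p) 1+r≢p
  1+n≡ : suc n ≡ n / p * p + suc (n % p)
  1+n≡ = trans (cong suc (m≡m%n+[m/n]*n n p)) (+-comm (suc (n % p)) _)
  p∤1+n : p ∤ suc n
  p∤1+n p∣1+n = <⇒≱ 1+r<p (∣⇒≤ (∣m+n∣m⇒∣n (subst (p ∣_) 1+n≡ p∣1+n) (n∣m*n (n / p))))
  1+n/p≡n/p : suc n / p ≡ n / p
  1+n/p≡n/p = trans (cong (_/ p) 1+n≡) (trans (+-distrib-/-∣ˡ (suc (n % p)) (n∣m*n (n / p)))
                (trans (cong₂ _+_ (m*n/n≡m (n / p) p) (m<n⇒m/n≡0 1+r<p)) (+-identityʳ _)))

m<n*[1+m/n] : ∀ m n .{{_ : NonZero n}} → m < n * suc (m / n)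
m<n*[1+m/n] m n = begin-strict
  m                   ≡⟨ m≡m%n+[m/n]*n m n ⟩
  m % n + m / n * n   <⟨ +-monoˡ-< (m / n * n) (m%n<n m n) ⟩
  n + m / n * n       ≡⟨ cong (λ k → n + k) (*-comm (m / n) n) ⟩
  n + n * (m / n)     ≡⟨ sym (*-suc n (m / n)) ⟩
  n * suc (m / n)     ∎
  where open ≤-Reasoning

module FiniteSum {A : Set} {_⊕_ : A → A → A} {ε : A}
                 (isCommutativeMonoid : IsCommutativeMonoid _≡_ _⊕_ ε) where

  open IsCommutativeMonoid isCommutativeMonoid using (assoc; identityˡ; identityʳ; isCommutativeSemigroup)
  ⊕-commutativeSemigroup : CommutativeSemigroup 0ℓ 0ℓ
  ⊕-commutativeSemigroup = record { isCommutativeSemigroup = isCommutativeSemigroup }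

  open CommutativeSemigroupProperties ⊕-commutativeSemigroup using (interchange)

  ∑ : ℕ → (ℕ → A) → A
  ∑ zero    f = ε
  ∑ (suc n) f = ∑ n f ⊕ f (suc n)

  when : Bool → A → A
  when b x = if b then x else ε

  ∑-cong : ∀ n {f g : ℕ → A} → (∀ k → 1 ≤ k → k ≤ n → f k ≡ g k) → ∑ n f ≡ ∑ n g
  ∑-cong zero    _ = refl
  ∑-cong (suc n) f≗g = cong₂ _⊕_ (∑-cong n (λ k 1≤k k≤n → f≗g k 1≤k (m≤n⇒m≤1+n k≤n))) (f≗g (suc n) (s≤s z≤n) ≤-refl)

  ∑-zero : ∀ n {f : ℕ → A} → (∀ k → 1 ≤ k → k ≤ n → f k ≡ ε) → ∑ n f ≡ ε
  ∑-zero zero    _ = refl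
  ∑-zero (suc n) f≗ε = trans (cong₂ _⊕_ (∑-zero n (λ k 1≤k k≤n → f≗ε k 1≤k (m≤n⇒m≤1+n k≤n))) (f≗ε (suc n) (s≤s z≤n) ≤-refl)) (identityʳ ε)

  ∑-distrib : ∀ n (f g : ℕ → A) → ∑ n (λ k → f k ⊕ g k) ≡ ∑ n f ⊕ ∑ n g
  ∑-distrib zero    f g = sym (identityʳ ε)
  ∑-distrib (suc n) f g = trans (cong (_⊕ (f (suc n) ⊕ g (suc n))) (∑-distrib n f g)) (interchange _ _ _ _)

  ∑-homo : (φ : A → A) → φ ε ≡ ε → (∀ x y → φ (x ⊕ y) ≡ φ x ⊕ φ y) →
           ∀ n (f : ℕ → A) → ∑ n (φ ∘ f) ≡ φ (∑ n f)
  ∑-homo φ φε φ⊕ zero    f = sym φε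
  ∑-homo φ φε φ⊕ (suc n) f = trans (cong (_⊕ φ (f (suc n))) (∑-homo φ φε φ⊕ n f)) (sym (φ⊕ _ _))

  when-homo : (φ : A → A) → φ ε ≡ ε → ∀ b x → when b (φ x) ≡ φ (when b x)
  when-homo φ φε true  x = refl
  when-homo φ φε false x = sym φε

  when-no : ∀ {P : Set} (P? : Dec P) {x} → ¬ P → when (does P?) x ≡ ε
  when-no P? ¬p = cong (λ b → when b _) (dec-false P? ¬p)

  when-ε : ∀ b → when b ε ≡ ε
  when-ε true  = refl
  when-ε false = refl

  ∑-truncate : ∀ m n {f : ℕ → A} → m ≤ n → (∀ k → m < k → k ≤ n → f k ≡ ε) → ∑ n f ≡ ∑ m f
  ∑-truncate m zero    z≤n _ = refl
  ∑-truncate m (suc n) m≤1+n f≡ε with m ≟ suc n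
  ... | yes refl = refl
  ... | no  m≢1+n = trans (cong₂ _⊕_ refl (f≡ε (suc n) m<1+n ≤-refl))
                     (trans (identityʳ _) (∑-truncate m n (≤-pred m<1+n) (λ k m<k k≤n → f≡ε k m<k (m≤n⇒m≤1+n k≤n))))
    where
    m<1+n : m < suc n
    m<1+n = ≤∧≢⇒< m≤1+n m≢1+n

  ∑-single : ∀ n a {f : ℕ → A} → 1 ≤ a → a ≤ n → (∀ k → k ≢ a → f k ≡ ε) → ∑ n f ≡ f a
  ∑-single zero    (suc _) _ () _
  ∑-single (suc n) a {f} 1≤a a≤1+n f≡ε with a ≟ suc n
  ... | yes refl = trans (cong (_⊕ f (suc n)) (∑-zero n (λ k _ k≤n → f≡ε k (<⇒≢ (s≤s k≤n))))) (identityˡ _)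
  ... | no  a≢1+n = trans (cong₂ _⊕_ (∑-single n a 1≤a (≤-pred (≤∧≢⇒< a≤1+n a≢1+n)) f≡ε) (f≡ε (suc n) (a≢1+n ∘ sym))) (identityʳ _)

  ∑-split : ∀ n (b : ℕ → Bool) (f : ℕ → A) → ∑ n f ≡ ∑ n (λ k → when (b k) (f k)) ⊕ ∑ n (λ k → when (not (b k)) (f k))
  ∑-split n b f = trans (∑-cong n (λ k _ _ → split k)) (∑-distrib n _ _)
    where
    split : ∀ k → f k ≡ when (b k) (f k) ⊕ when (not (b k)) (f k)
    split k with b k
    ... | true  = sym (identityʳ _)
    ... | false = sym (identityˡ _)

  ∑-multiples : ∀ p .{{_ : NonZero p}} n (f : ℕ → A) →
                ∑ n (λ k → when (divides p k) (f k)) ≡ ∑ (n / p) (λ j → f (p * j))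
  ∑-multiples p zero    f = cong (λ m → ∑ m (λ j → f (p * j))) (sym (0/n≡0 p))
  ∑-multiples p (suc n) f = trans (cong (_⊕ when (divides p (suc n)) (f (suc n))) (∑-multiples p n f)) (last-term (suc-/ p n))
    where
    open ≡-Reasoning
    F : ℕ → A
    F j = f (p * j)
    last-term : suc n ≡ p * suc (n / p) ⊎ (p ∤ suc n × suc n / p ≡ n / p) →
                ∑ (n / p) F ⊕ when (divides p (suc n)) (f (suc n)) ≡ ∑ (suc n / p) F
    last-term (inj₁ 1+n≡) = begin
      ∑ (n / p) F ⊕ when (divides p (suc n)) (f (suc n)) ≡⟨ cong (λ b → ∑ (n / p) F ⊕ when b (f (suc n))) (dec-true (p ∣? suc n) p∣1+n) ⟩
      ∑ (n / p) F ⊕ f (suc n)                            ≡⟨ cong (λ m → ∑ (n / p) F ⊕ f m) 1+n≡ ⟩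
      ∑ (suc (n / p)) F                                  ≡⟨ cong (λ m → ∑ m F) (sym 1+n/p≡) ⟩
      ∑ (suc n / p) F                                    ∎
      where
      p∣1+n : p ∣ suc n
      p∣1+n = subst (p ∣_) (sym 1+n≡) (m∣m*n (suc (n / p)))
      1+n/p≡ : suc n / p ≡ suc (n / p)
      1+n/p≡ = trans (cong (_/ p) 1+n≡) (trans (cong (_/ p) (*-comm p _)) (m*n/n≡m _ p))
    last-term (inj₂ (p∤1+n , 1+n/p≡n/p)) = begin
      ∑ (n / p) F ⊕ when (divides p (suc n)) (f (suc n)) ≡⟨ cong (λ b → ∑ (n / p) F ⊕ when b (f (suc n))) (dec-false (p ∣? suc n) p∤1+n) ⟩
      ∑ (n / p) F ⊕ ε                                    ≡⟨ identityʳ _ ⟩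
      ∑ (n / p) F                                        ≡⟨ cong (λ m → ∑ m F) (sym 1+n/p≡n/p) ⟩
      ∑ (suc n / p) F                                    ∎

  sum-∷ʳ : ∀ xs x → foldr _⊕_ ε (xs ++ x ∷ []) ≡ foldr _⊕_ ε xs ⊕ x
  sum-∷ʳ []       x = trans (identityʳ x) (sym (identityˡ x))
  sum-∷ʳ (y ∷ xs) x = trans (cong (y ⊕_) (sum-∷ʳ xs x)) (sym (assoc y _ x))

  sum-range1 : ∀ (f : ℕ → A) n → foldr _⊕_ ε (map f (range1 n)) ≡ ∑ n f
  sum-range1 f zero    = refl
  sum-range1 f (suc n) = begin
    foldr _⊕_ ε (map f (range1 (suc n)))           ≡⟨ cong (foldr _⊕_ ε ∘ map f) (sym (List.applyUpTo-∷ʳ suc n)) ⟩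
    foldr _⊕_ ε (map f (range1 n ++ suc n ∷ []))   ≡⟨ cong (foldr _⊕_ ε) (List.map-++ f (range1 n) _) ⟩
    foldr _⊕_ ε (map f (range1 n) ++ f (suc n) ∷ []) ≡⟨ sum-∷ʳ (map f (range1 n)) (f (suc n)) ⟩
    foldr _⊕_ ε (map f (range1 n)) ⊕ f (suc n)     ≡⟨ cong (_⊕ f (suc n)) (sum-range1 f n) ⟩
    ∑ (suc n) f                                    ∎
    where open ≡-Reasoning

  sum-filterᵇ : ∀ (b : ℕ → Bool) (f : ℕ → A) xs →
                foldr _⊕_ ε (map f (filterᵇ b xs)) ≡ foldr _⊕_ ε (map (λ x → when (b x) (f x)) xs)
  sum-filterᵇ b f []       = refl
  sum-filterᵇ b f (x ∷ xs) with b x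
  ... | true  = cong (f x ⊕_) (sum-filterᵇ b f xs)
  ... | false = trans (sum-filterᵇ b f xs) (sym (identityˡ _))

open FiniteSum ℚP.+-0-isCommutativeMonoid
module ℕΣ = FiniteSum +-0-isCommutativeMonoid

ℚ-ring : ACR.AlmostCommutativeRing 0ℓ 0ℓ
ℚ-ring = ACR.fromCommutativeRing ℚP.+-*-commutativeRing (λ x → Relation.Nullary.Decidable.dec⇒maybe (0ℚ ℚP.≟ x))

module ℚ* = CommutativeSemigroupProperties (CommutativeMonoid.commutativeSemigroup ℚP.*-1-commutativeMonoid)

*-distribˡ-- : ∀ c x y → c ℚ.* x ℚ.- c ℚ.* y ≡ c ℚ.* (x ℚ.- y)
*-distribˡ-- = RingSolver.solve-∀ ℚ-ring

ι : ℕ → ℚ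
ι n = + n ℚ./ 1

1/ι : ℕ → ℚ
1/ι zero    = 0ℚ
1/ι (suc n) = + 1 ℚ./ suc n

ιℤ : ℤ → ℚ
ιℤ z = z ℚ./ 1

fromℚᵘ-homo-+ : ∀ x y → ℚ.fromℚᵘ (x ℚᵘ.+ y) ≡ ℚ.fromℚᵘ x ℚ.+ ℚ.fromℚᵘ y
fromℚᵘ-homo-+ x y = sym (ℚP.toℚᵘ-injective (ℚᵘP.≃-trans (ℚP.toℚᵘ-homo-+ (ℚ.fromℚᵘ x) (ℚ.fromℚᵘ y))
  (ℚᵘP.≃-trans (ℚᵘP.+-cong (ℚP.toℚᵘ-fromℚᵘ x) (ℚP.toℚᵘ-fromℚᵘ y)) (ℚᵘP.≃-sym (ℚP.toℚᵘ-fromℚᵘ (x ℚᵘ.+ y))))))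

fromℚᵘ-homo-* : ∀ x y → ℚ.fromℚᵘ (x ℚᵘ.* y) ≡ ℚ.fromℚᵘ x ℚ.* ℚ.fromℚᵘ y
fromℚᵘ-homo-* x y = sym (ℚP.toℚᵘ-injective (ℚᵘP.≃-trans (ℚP.toℚᵘ-homo-* (ℚ.fromℚᵘ x) (ℚ.fromℚᵘ y))
  (ℚᵘP.≃-trans (ℚᵘP.*-cong (ℚP.toℚᵘ-fromℚᵘ x) (ℚP.toℚᵘ-fromℚᵘ y)) (ℚᵘP.≃-sym (ℚP.toℚᵘ-fromℚᵘ (x ℚᵘ.* y))))))

ι-+ : ∀ m n → ι (m + n) ≡ ι m ℚ.+ ι n
ι-+ m n = trans (ℚP.fromℚᵘ-cong m+n≃) (fromℚᵘ-homo-+ (mkℚᵘ (+ m) 0) (mkℚᵘ (+ n) 0))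
  where
  m+n≃ : mkℚᵘ (+ (m + n)) 0 ℚᵘ.≃ mkℚᵘ (+ m) 0 ℚᵘ.+ mkℚᵘ (+ n) 0
  m+n≃ = *≡* (trans (ℤP.*-identityʳ _) (trans (ℤP.pos-+ m n)
    (sym (trans (ℤP.*-identityʳ _) (cong₂ ℤ._+_ (ℤP.*-identityʳ (+ m)) (ℤP.*-identityʳ (+ n)))))))

ι-* : ∀ m n → ι (m * n) ≡ ι m ℚ.* ι n
ι-* m n = trans (ℚP.fromℚᵘ-cong m*n≃) (fromℚᵘ-homo-* (mkℚᵘ (+ m) 0) (mkℚᵘ (+ n) 0))
  where
  m*n≃ : mkℚᵘ (+ (m * n)) 0 ℚᵘ.≃ mkℚᵘ (+ m) 0 ℚᵘ.* mkℚᵘ (+ n) 0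
  m*n≃ = *≡* (cong (ℤ._* + 1) (ℤP.pos-* m n))

ιℤ-* : ∀ i j → ιℤ (i ℤ.* j) ≡ ιℤ i ℚ.* ιℤ j
ιℤ-* i j = trans (ℚP.fromℚᵘ-cong i*j≃) (fromℚᵘ-homo-* (mkℚᵘ i 0) (mkℚᵘ j 0))
  where
  i*j≃ : mkℚᵘ (i ℤ.* j) 0 ℚᵘ.≃ mkℚᵘ i 0 ℚᵘ.* mkℚᵘ j 0
  i*j≃ = *≡* refl

1/ι-* : ∀ m n → 1/ι (m * n) ≡ 1/ι m ℚ.* 1/ι n
1/ι-* zero    n       = sym (ℚP.*-zeroˡ (1/ι n))
1/ι-* (suc m) zero    = trans (cong 1/ι (*-zeroʳ m)) (sym (ℚP.*-zeroʳ (1/ι (suc m))))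
1/ι-* (suc m) (suc n) = trans (ℚP.fromℚᵘ-cong 1/mn≃) (fromℚᵘ-homo-* (mkℚᵘ (+ 1) m) (mkℚᵘ (+ 1) n))
  where
  1/mn≃ : mkℚᵘ (+ 1) (n + m * suc n) ℚᵘ.≃ mkℚᵘ (+ 1) m ℚᵘ.* mkℚᵘ (+ 1) n
  1/mn≃ = *≡* refl

ι*1/ι≡1 : ∀ {n} → 1 ≤ n → ι n ℚ.* 1/ι n ≡ 1ℚ
ι*1/ι≡1 {suc n} _ = trans (sym (fromℚᵘ-homo-* (mkℚᵘ (+ suc n) 0) (mkℚᵘ (+ 1) n))) (ℚP.fromℚᵘ-cong n/n≃1)
  where
  n/n≃1 : mkℚᵘ (+ suc n) 0 ℚᵘ.* mkℚᵘ (+ 1) n ℚᵘ.≃ mkℚᵘ (+ 1) 0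
  n/n≃1 = *≡* (cong (+_ ∘ suc) (trans (*-identityʳ (n * 1)) (trans (*-identityʳ n) (sym (trans (+-identityʳ (n + 0)) (+-identityʳ n))))))

÷ℕ≡ : ∀ z n → z ÷ℕ n ≡ ιℤ z ℚ.* 1/ι n
÷ℕ≡ z zero    = sym (ℚP.*-zeroʳ (ιℤ z))
÷ℕ≡ z (suc n) = trans (ℚP.fromℚᵘ-cong z/n≃) (fromℚᵘ-homo-* (mkℚᵘ z 0) (mkℚᵘ (+ 1) n))
  where
  z/n≃ : mkℚᵘ z n ℚᵘ.≃ mkℚᵘ z 0 ℚᵘ.* mkℚᵘ (+ 1) n
  z/n≃ = *≡* (cong₂ ℤ._*_ (sym (ℤP.*-identityʳ z)) (cong (+_ ∘ suc) (+-identityʳ n)))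

ι[n]*1/ι[m*n]≡1/ι[m] : ∀ m n → 1 ≤ n → ι n ℚ.* 1/ι (m * n) ≡ 1/ι m
ι[n]*1/ι[m*n]≡1/ι[m] m n 1≤n = begin
  ι n ℚ.* 1/ι (m * n)        ≡⟨ cong (ι n ℚ.*_) (1/ι-* m n) ⟩
  ι n ℚ.* (1/ι m ℚ.* 1/ι n)  ≡⟨ ℚ*.x∙yz≈y∙xz (ι n) (1/ι m) (1/ι n) ⟩
  1/ι m ℚ.* (ι n ℚ.* 1/ι n)  ≡⟨ cong (1/ι m ℚ.*_) (ι*1/ι≡1 1≤n) ⟩
  1/ι m ℚ.* 1ℚ               ≡⟨ ℚP.*-identityʳ (1/ι m) ⟩
  1/ι m                      ∎
  where open ≡-Reasoning

1-1/ι≡ : ∀ {p} → 1 ≤ p → 1ℚ ℚ.- 1/ι p ≡ ι (p ∸ 1) ℚ.* 1/ι p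
1-1/ι≡ {suc p} _ = begin
  1ℚ ℚ.- 1/ι (suc p)                          ≡⟨ cong (ℚ._- 1/ι (suc p)) (sym (ι*1/ι≡1 {suc p} (s≤s z≤n))) ⟩
  ι (1 + p) ℚ.* 1/ι (suc p) ℚ.- 1/ι (suc p)   ≡⟨ cong (λ x → x ℚ.* 1/ι (suc p) ℚ.- 1/ι (suc p)) (ι-+ 1 p) ⟩
  (1ℚ ℚ.+ ι p) ℚ.* 1/ι (suc p) ℚ.- 1/ι (suc p) ≡⟨ cancel (ι p) (1/ι (suc p)) ⟩
  ι p ℚ.* 1/ι (suc p)                         ∎
  where
  open ≡-Reasoning
  cancel : ∀ x r → (1ℚ ℚ.+ x) ℚ.* r ℚ.- r ≡ x ℚ.* r
  cancel = RingSolver.solve-∀ ℚ-ring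

ιℤ-neg : ∀ z → ιℤ (ℤ.- z) ≡ ℚ.- ιℤ z
ιℤ-neg (+ zero)  = refl
ιℤ-neg (+ suc n) = refl
ιℤ-neg -[1+ n ]  = sym (neg-involutive (ιℤ (+ suc n)))
  where
  neg-involutive : ∀ x → ℚ.- (ℚ.- x) ≡ x
  neg-involutive = RingSolver.solve-∀ ℚ-ring

∑-neg : ∀ n (f : ℕ → ℚ) → ∑ n (λ k → ℚ.- f k) ≡ ℚ.- ∑ n f
∑-neg = ∑-homo ℚ.-_ refl ℚP.neg-distrib-+

∑-*ˡ : ∀ c n (f : ℕ → ℚ) → ∑ n (λ k → c ℚ.* f k) ≡ c ℚ.* ∑ n f
∑-*ˡ c = ∑-homo (c ℚ.*_) (ℚP.*-zeroʳ c) (ℚP.*-distribˡ-+ c)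

when-*ˡ : ∀ c b x → when b (c ℚ.* x) ≡ c ℚ.* when b x
when-*ˡ c = when-homo (c ℚ.*_) (ℚP.*-zeroʳ c)

fromℚᵘ-mono-≤ : ∀ x y → x ℚᵘ.≤ y → ℚ.fromℚᵘ x ℚ.≤ ℚ.fromℚᵘ y
fromℚᵘ-mono-≤ x y x≤y = ℚP.toℚᵘ-cancel-≤
  (ℚᵘP.≤-respˡ-≃ (ℚᵘP.≃-sym (ℚP.toℚᵘ-fromℚᵘ x)) (ℚᵘP.≤-respʳ-≃ (ℚᵘP.≃-sym (ℚP.toℚᵘ-fromℚᵘ y)) x≤y))

fromℚᵘ-mono-< : ∀ x y → x ℚᵘ.< y → ℚ.fromℚᵘ x ℚ.< ℚ.fromℚᵘ y
fromℚᵘ-mono-< x y x<y = ℚP.toℚᵘ-cancel-<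
  (ℚᵘP.<-respˡ-≃ (ℚᵘP.≃-sym (ℚP.toℚᵘ-fromℚᵘ x)) (ℚᵘP.<-respʳ-≃ (ℚᵘP.≃-sym (ℚP.toℚᵘ-fromℚᵘ y)) x<y))

ι-mono-≤ : ∀ {m n} → m ≤ n → ι m ℚ.≤ ι n
ι-mono-≤ {m} {n} m≤n = fromℚᵘ-mono-≤ (mkℚᵘ (+ m) 0) (mkℚᵘ (+ n) 0)
  (ℚᵘ.*≤* (subst₂ ℤ._≤_ (sym (ℤP.*-identityʳ (+ m))) (sym (ℤP.*-identityʳ (+ n))) (ℤ.+≤+ m≤n)))

1/ι-anti-≤ : ∀ {m n} → 1 ≤ m → m ≤ n → 1/ι n ℚ.≤ 1/ι m
1/ι-anti-≤ {suc m} {suc n} _ m≤n = fromℚᵘ-mono-≤ (mkℚᵘ (+ 1) n) (mkℚᵘ (+ 1) m)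
  (ℚᵘ.*≤* (subst₂ ℤ._≤_ (sym (ℤP.*-identityˡ (+ suc m))) (sym (ℤP.*-identityˡ (+ suc n))) (ℤ.+≤+ m≤n)))

0≤ι : ∀ n → 0ℚ ℚ.≤ ι n
0≤ι n = ι-mono-≤ {0} {n} z≤n

0≤1/ι : ∀ n → 0ℚ ℚ.≤ 1/ι n
0≤1/ι zero    = ℚP.≤-refl
0≤1/ι (suc n) = fromℚᵘ-mono-≤ (mkℚᵘ (+ 0) 0) (mkℚᵘ (+ 1) n) (ℚᵘ.*≤* (ℤ.+≤+ z≤n))

*-monoˡ-≤-0≤ : ∀ {a b c} → 0ℚ ℚ.≤ c → a ℚ.≤ b → c ℚ.* a ℚ.≤ c ℚ.* b
*-monoˡ-≤-0≤ {c = c} 0≤c = ℚP.*-monoˡ-≤-nonNeg c {{ℚ.nonNegative 0≤c}}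

*-monoʳ-≤-0≤ : ∀ {a b c} → 0ℚ ℚ.≤ c → a ℚ.≤ b → a ℚ.* c ℚ.≤ b ℚ.* c
*-monoʳ-≤-0≤ {c = c} 0≤c = ℚP.*-monoʳ-≤-nonNeg c {{ℚ.nonNegative 0≤c}}

0≤* : ∀ {a b} → 0ℚ ℚ.≤ a → 0ℚ ℚ.≤ b → 0ℚ ℚ.≤ a ℚ.* b
0≤* {a} {b} 0≤a 0≤b = ℚP.≤-trans (ℚP.≤-reflexive (sym (ℚP.*-zeroˡ b))) (*-monoʳ-≤-0≤ 0≤b 0≤a)

prime⇒≥2 : ∀ {p} → Prime p → 2 ≤ p
prime⇒≥2 {p} p-prime = ℕ.nonTrivial⇒n>1 p {{prime⇒nonTrivial p-prime}}

prime⇒≥1 : ∀ {p} → Prime p → 1 ≤ p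
prime⇒≥1 p-prime = ≤-trans (s≤s z≤n) (prime⇒≥2 p-prime)

prime∣prime⇒≡ : ∀ {p q} → Prime p → Prime q → q ∣ p → q ≡ p
prime∣prime⇒≡ p-prime q-prime q∣p with prime⇒irreducible p-prime q∣p
... | inj₁ refl = ⊥-elim (¬prime[1] q-prime)
... | inj₂ q≡p = q≡p

prime∣^⇒∣ : ∀ {q} p k → Prime q → q ∣ p ^ k → q ∣ p
prime∣^⇒∣ p zero    q-prime q∣1 = ⊥-elim (¬prime[1] (subst Prime (∣1⇒≡1 q∣1) q-prime))
prime∣^⇒∣ p (suc k) q-prime q∣p^k+1 with euclidsLemma p (p ^ k) q-prime q∣p^k+1
... | inj₁ q∣p   = q∣p
... | inj₂ q∣p^k = prime∣^⇒∣ p k q-prime q∣p^k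

primeFactor : ∀ n → 2 ≤ n → ∃ λ q → Prime q × q ∣ n
primeFactor n 2≤n with factorise n {{ℕ.>-nonZero (≤-trans (s≤s z≤n) 2≤n)}}
... | record { factors = [] ; isFactorisation = n≡1 } = ⊥-elim (<-irrefl (sym n≡1) 2≤n)
... | record { factors = q ∷ qs ; isFactorisation = n≡q*qs ; factorsPrime = q-prime All.∷ _ } =
      q , q-prime , subst (q ∣_) (sym n≡q*qs) (m∣m*n (product qs))

≢0⇒≥1 : ∀ {n} → n ≢ 0 → 1 ≤ n
≢0⇒≥1 {zero}  n≢0 = ⊥-elim (n≢0 refl)
≢0⇒≥1 {suc n} _   = s≤s z≤n

∣≥1⇒≥1 : ∀ {m n} → 1 ≤ n → m ∣ n → 1 ≤ m
∣≥1⇒≥1 1≤n m∣n = ≢0⇒≥1 (λ { refl → <-irrefl (sym (0∣⇒≡0 m∣n)) 1≤n })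

noCommonPrime⇒coprime : ∀ {a b} → 1 ≤ a → (∀ q → Prime q → q ∣ a → q ∣ b → ⊥) → Coprime a b
noCommonPrime⇒coprime {a} {b} 1≤a no-common {c} (c∣a , c∣b) with c ≟ 1
... | yes c≡1 = c≡1
... | no  c≢1 with primeFactor c (≤∧≢⇒< (∣≥1⇒≥1 1≤a c∣a) (c≢1 ∘ sym))
...   | q , q-prime , q∣c = ⊥-elim (no-common q q-prime (∣-trans q∣c c∣a) (∣-trans q∣c c∣b))

distinctPrimes⇒coprime : ∀ {p q} → Prime p → Prime q → p ≢ q → Coprime p q
distinctPrimes⇒coprime p-prime q-prime p≢q = noCommonPrime⇒coprime (prime⇒≥1 p-prime)
  (λ r r-prime r∣p r∣q → p≢q (trans (sym (prime∣prime⇒≡ p-prime r-prime r∣p)) (prime∣prime⇒≡ q-prime r-prime r∣q)))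

prime∤⇒coprime : ∀ {p a} → Prime p → 1 ≤ a → p ∤ a → Coprime a p
prime∤⇒coprime p-prime 1≤a p∤a =
  noCommonPrime⇒coprime 1≤a (λ q q-prime q∣a q∣p → p∤a (subst (_∣ _) (prime∣prime⇒≡ p-prime q-prime q∣p) q∣a))

coprime⇒*∣ : ∀ {a b c} → Coprime a b → a ∣ c → b ∣ c → a * b ∣ c
coprime⇒*∣ {a} {b} {c} a⊥b a∣c b∣c with a∣c
... | Data.Nat.Divisibility.divides k refl =
  subst (a * b ∣_) (*-comm a k) (*-monoʳ-∣ a (coprime-divisor (Data.Nat.Coprimality.sym a⊥b) (subst (b ∣_) (*-comm k a) b∣c)))

data DistinctPrimes : List ℕ → Set where
  []   : DistinctPrimes []
  cons : ∀ {p Q} → Prime p → p ∉ Q → DistinctPrimes Q → DistinctPrimes (p ∷ Q)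

ComposedOf : List ℕ → ℕ → Set
ComposedOf Q n = ∀ q → Prime q → q ∣ n → q ∈ Q

∈-distinctPrimes⇒prime : ∀ {Q q} → DistinctPrimes Q → q ∈ Q → Prime q
∈-distinctPrimes⇒prime (cons p-prime _ _) (here refl) = p-prime
∈-distinctPrimes⇒prime (cons _ _ Q-primes) (there q∈Q) = ∈-distinctPrimes⇒prime Q-primes q∈Q

prime∣product⇒∈ : ∀ {Q q} → DistinctPrimes Q → Prime q → q ∣ product Q → q ∈ Q
prime∣product⇒∈ [] q-prime q∣1 = ⊥-elim (¬prime[1] (subst Prime (∣1⇒≡1 q∣1) q-prime))
prime∣product⇒∈ {p ∷ Q} (cons p-prime _ Q-primes) q-prime q∣p*ΠQ with euclidsLemma p (product Q) q-prime q∣p*ΠQ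
... | inj₁ q∣p  = here (prime∣prime⇒≡ p-prime q-prime q∣p)
... | inj₂ q∣ΠQ = there (prime∣product⇒∈ Q-primes q-prime q∣ΠQ)

∈⇒∣product : ∀ {Q q} → q ∈ Q → q ∣ product Q
∈⇒∣product {p ∷ Q} (here refl) = m∣m*n (product Q)
∈⇒∣product {p ∷ Q} (there q∈Q) = ∣n⇒∣m*n p (∈⇒∣product q∈Q)

product∣ : ∀ {Q n} → DistinctPrimes Q → (∀ {q} → q ∈ Q → q ∣ n) → product Q ∣ n
product∣ []                          _     = 1∣ _
product∣ {p ∷ Q} (cons p-prime p∉Q Q-primes) Q∣n = coprime⇒*∣ p⊥ΠQ (Q∣n (here refl)) (product∣ Q-primes (Q∣n ∘ there))
  where
  p⊥ΠQ : Coprime p (product Q)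
  p⊥ΠQ = noCommonPrime⇒coprime (prime⇒≥1 p-prime) λ q q-prime q∣p q∣ΠQ →
    p∉Q (subst (_∈ Q) (prime∣prime⇒≡ p-prime q-prime q∣p) (prime∣product⇒∈ Q-primes q-prime q∣ΠQ))

∈-range1⁺ : ∀ {k n} → 1 ≤ k → k ≤ n → k ∈ range1 n
∈-range1⁺ {suc k} _ k<n = ∈-applyUpTo⁺ suc k<n

∈-filterᵇ⁻ : ∀ (b : ℕ → Bool) {x xs} → x ∈ filterᵇ b xs → x ∈ xs × T (b x)
∈-filterᵇ⁻ b = ∈-filter⁻ (Relation.Nullary.Decidable.T? ∘ b)

∈-filterᵇ⁺ : ∀ (b : ℕ → Bool) {x xs} → x ∈ xs → T (b x) → x ∈ filterᵇ b xs
∈-filterᵇ⁺ b = ∈-filter⁺ (Relation.Nullary.Decidable.T? ∘ b)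

primeDivisor? : ∀ n p → Dec (Prime p × p ∣ n)
primeDivisor? n p = prime? p ×-dec p ∣? n

∈-primeDivisors⁻ : ∀ {p n} → p ∈ primeDivisors n → Prime p × p ∣ n
∈-primeDivisors⁻ {p} {n} p∈ = T-does⁻¹ (primeDivisor? n p) (proj₂ (∈-filterᵇ⁻ (λ q → isPrime q ∧ divides q n) {xs = range1 n} p∈))

∈-primeDivisors⁺ : ∀ {p n} → 1 ≤ n → Prime p → p ∣ n → p ∈ primeDivisors n
∈-primeDivisors⁺ {p} {n} 1≤n p-prime p∣n = ∈-filterᵇ⁺ (λ q → isPrime q ∧ divides q n)
  (∈-range1⁺ (prime⇒≥1 p-prime) (∣⇒≤ {{ℕ.>-nonZero 1≤n}} p∣n)) (T-does (primeDivisor? n p) (p-prime , p∣n))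

primeDivisors-distinct : ∀ n → DistinctPrimes (primeDivisors n)
primeDivisors-distinct n = fromAllPairs (Unique.filter⁺ _ range1-unique) (proj₁ ∘ ∈-primeDivisors⁻ {n = n})
  where
  range1-unique : AllPairs _≢_ (range1 n)
  range1-unique = Unique.applyUpTo⁺₁ suc n (λ i<j _ 1+i≡1+j → <-irrefl (suc-injective 1+i≡1+j) i<j)
  fromAllPairs : ∀ {Q} → AllPairs _≢_ Q → (∀ {q} → q ∈ Q → Prime q) → DistinctPrimes Q
  fromAllPairs []                 _     = []
  fromAllPairs (p≢Q ∷ Q-distinct) prime = cons (prime (here refl)) (λ p∈Q → All.lookup p≢Q p∈Q refl) (fromAllPairs Q-distinct (prime ∘ there))

rad : ℕ → ℕ
rad n = product (primeDivisors n)

rad∣ : ∀ n → rad n ∣ n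
rad∣ n = product∣ (primeDivisors-distinct n) (proj₂ ∘ ∈-primeDivisors⁻ {n = n})

-- The Möbius function

length≡sum-ones : ∀ (xs : List ℕ) → length xs ≡ foldr _+_ 0 (map (λ _ → 1) xs)
length≡sum-ones []       = refl
length≡sum-ones (x ∷ xs) = cong suc (length≡sum-ones xs)

length-filterᵇ : ∀ (b : ℕ → Bool) n → length (filterᵇ b (range1 n)) ≡ ℕΣ.∑ n (λ k → ℕΣ.when (b k) 1)
length-filterᵇ b n = begin
  length (filterᵇ b (range1 n))                                      ≡⟨ length≡sum-ones (filterᵇ b (range1 n)) ⟩
  foldr _+_ 0 (map (λ _ → 1) (filterᵇ b (range1 n)))                 ≡⟨ ℕΣ.sum-filterᵇ b (λ _ → 1) (range1 n) ⟩
  foldr _+_ 0 (map (λ k → ℕΣ.when (b k) 1) (range1 n))               ≡⟨ ℕΣ.sum-range1 _ n ⟩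
  ℕΣ.∑ n (λ k → ℕΣ.when (b k) 1)                                     ∎
  where open ≡-Reasoning

squareFree : ℕ → Bool
squareFree n = foldr (λ p b → not (divides (p * p) n) ∧ b) true (primeDivisors n)

sign : ℕ → ℤ
sign zero    = + 1
sign (suc k) = ℤ.- sign k

-- Defs.μ computes the sign with a local copy of sign; sign-unique identifies the two.
μ-unfold : ∀ n → μ n ≡ (if squareFree n then sign (length (primeDivisors n)) else + 0)
μ-unfold n with squareFree n
... | false = refl
... | true  with length (primeDivisors n) | sign-unique _ refl (λ _ → refl)
  where
  sign-unique : (s : ℕ → ℤ) → s 0 ≡ + 1 → (∀ k → s (suc k) ≡ ℤ.- s k) → ∀ k → s k ≡ sign k
  sign-unique s s0 s-suc zero    = s0
  sign-unique s s0 s-suc (suc k) = trans (s-suc k) (cong ℤ.-_ (sign-unique s s0 s-suc k))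
...   | k | s≡sign = s≡sign k

squareFree⁻ : ∀ {n} → 1 ≤ n → T (squareFree n) → ∀ p → Prime p → p * p ∤ n
squareFree⁻ {n} 1≤n sf p p-prime p²∣n = T-not-does⁻¹ (p * p ∣? n)
  (T-all⁻ (λ q → not (divides (q * q) n)) (primeDivisors n) sf (∈-primeDivisors⁺ 1≤n p-prime (∣-trans (m∣m*n p) p²∣n))) p²∣n

squareFree⁺ : ∀ {n} → (∀ p → Prime p → p * p ∤ n) → T (squareFree n)
squareFree⁺ {n} no-square = T-all⁺ (λ q → not (divides (q * q) n)) (primeDivisors n)
  (λ {q} q∈ → T-not-does (q * q ∣? n) (no-square q (proj₁ (∈-primeDivisors⁻ {n = n} q∈))))

primeDivisor-indicator-p* : ∀ {p β} → Prime p → p ∤ β → ∀ k →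
  ℕΣ.when (does (primeDivisor? (p * β) k)) 1 ≡ ℕΣ.when (does (k ≟ p)) 1 + ℕΣ.when (does (primeDivisor? β k)) 1
primeDivisor-indicator-p* {p} {β} p-prime p∤β k with k ≟ p
... | yes refl = trans (cong (λ b → ℕΣ.when b 1) (dec-true (primeDivisor? (p * β) p) (p-prime , m∣m*n β)))
  (cong₂ (λ a b → ℕΣ.when a 1 + ℕΣ.when b 1) (sym (dec-true (p ≟ p) refl)) (sym (dec-false (primeDivisor? β p) (p∤β ∘ proj₂))))
... | no k≢p = trans (cong (λ b → ℕΣ.when b 1) (does-⇔ (mk⇔ to from) (primeDivisor? (p * β) k) (primeDivisor? β k)))
  (cong (λ a → ℕΣ.when a 1 + ℕΣ.when (does (primeDivisor? β k)) 1) (sym (dec-false (k ≟ p) k≢p)))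
  where
  to : Prime k × k ∣ p * β → Prime k × k ∣ β
  to (k-prime , k∣pβ) with euclidsLemma p β k-prime k∣pβ
  ... | inj₁ k∣p = ⊥-elim (k≢p (prime∣prime⇒≡ p-prime k-prime k∣p))
  ... | inj₂ k∣β = k-prime , k∣β
  from : Prime k × k ∣ β → Prime k × k ∣ p * β
  from (k-prime , k∣β) = k-prime , ∣n⇒∣m*n p k∣β

length-primeDivisors-p* : ∀ {p β} → Prime p → 1 ≤ β → p ∤ β →
                          length (primeDivisors (p * β)) ≡ suc (length (primeDivisors β))
length-primeDivisors-p* {p} {β} p-prime 1≤β p∤β = begin
  length (primeDivisors (p * β))                                     ≡⟨ length-filterᵇ _ (p * β) ⟩
  ℕΣ.∑ (p * β) (λ k → ℕΣ.when (PD (p * β) k) 1)                      ≡⟨ ℕΣ.∑-cong (p * β) (λ k _ _ → primeDivisor-indicator-p* p-prime p∤β k) ⟩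
  ℕΣ.∑ (p * β) (λ k → ℕΣ.when (does (k ≟ p)) 1 + ℕΣ.when (PD β k) 1) ≡⟨ ℕΣ.∑-distrib (p * β) _ _ ⟩
  ℕΣ.∑ (p * β) (λ k → ℕΣ.when (does (k ≟ p)) 1) + ℕΣ.∑ (p * β) (λ k → ℕΣ.when (PD β k) 1)
    ≡⟨ cong₂ _+_ (trans (ℕΣ.∑-single (p * β) p (prime⇒≥1 p-prime) p≤pβ only-p) (cong (λ b → ℕΣ.when b 1) (dec-true (p ≟ p) refl)))
                 (ℕΣ.∑-truncate β (p * β) β≤pβ beyond-β) ⟩
  1 + ℕΣ.∑ β (λ k → ℕΣ.when (PD β k) 1)                              ≡⟨ cong suc (sym (length-filterᵇ _ β)) ⟩
  suc (length (primeDivisors β))                                     ∎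
  where
  open ≡-Reasoning
  PD : ℕ → ℕ → Bool
  PD n k = does (primeDivisor? n k)
  p≤pβ : p ≤ p * β
  p≤pβ = m≤m*n p β {{ℕ.>-nonZero 1≤β}}
  β≤pβ : β ≤ p * β
  β≤pβ = m≤n*m β p {{prime⇒nonZero p-prime}}
  only-p : ∀ k → k ≢ p → ℕΣ.when (does (k ≟ p)) 1 ≡ 0
  only-p k k≢p = ℕΣ.when-no (k ≟ p) k≢p
  beyond-β : ∀ k → β < k → k ≤ p * β → ℕΣ.when (PD β k) 1 ≡ 0
  beyond-β k β<k _ = ℕΣ.when-no (primeDivisor? β k) (λ (_ , k∣β) → <⇒≱ β<k (∣⇒≤ {{ℕ.>-nonZero 1≤β}} k∣β))

squareFree-p* : ∀ {p β} → Prime p → 1 ≤ β → p ∤ β → squareFree (p * β) ≡ squareFree β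
squareFree-p* {p} {β} p-prime 1≤β p∤β = T-ext
  (λ sf → squareFree⁺ (λ q q-prime q²∣β → squareFree⁻ (*-mono-≤ (prime⇒≥1 p-prime) 1≤β) sf q q-prime (∣n⇒∣m*n p q²∣β)))
  (λ sf → squareFree⁺ (λ q q-prime q²∣pβ → squareFree⁻ 1≤β sf q q-prime (cancel-p q q-prime q²∣pβ)))
  where
  cancel-p : ∀ q → Prime q → q * q ∣ p * β → q * q ∣ β
  cancel-p q q-prime q²∣pβ with q ≟ p
  ... | yes refl = ⊥-elim (p∤β (*-cancelˡ-∣ q {{prime⇒nonZero q-prime}} q²∣pβ))
  ... | no  q≢p  = coprime-divisor (noCommonPrime⇒coprime (*-mono-≤ (prime⇒≥1 q-prime) (prime⇒≥1 q-prime)) q²⊥p) q²∣pβ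
    where
    q²⊥p : ∀ r → Prime r → r ∣ q * q → r ∣ p → ⊥
    q²⊥p r r-prime r∣q² r∣p = q≢p (trans (sym (prime∣prime⇒≡ q-prime r-prime r∣q)) (prime∣prime⇒≡ p-prime r-prime r∣p))
      where
      r∣q : r ∣ q
      r∣q = reduce (euclidsLemma q q r-prime r∣q²)

μ[p*n]≡-μ[n] : ∀ {p n} → Prime p → 1 ≤ n → p ∤ n → μ (p * n) ≡ ℤ.- μ n
μ[p*n]≡-μ[n] {p} {n} p-prime 1≤n p∤n = begin
  μ (p * n)                                                         ≡⟨ μ-unfold (p * n) ⟩
  (if squareFree (p * n) then sign (length (primeDivisors (p * n))) else + 0)
    ≡⟨ cong₂ (λ b k → if b then sign k else + 0) (squareFree-p* p-prime 1≤n p∤n) (length-primeDivisors-p* p-prime 1≤n p∤n) ⟩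
  (if squareFree n then ℤ.- sign (length (primeDivisors n)) else + 0) ≡⟨ negate-branch (squareFree n) ⟩
  ℤ.- (if squareFree n then sign (length (primeDivisors n)) else + 0) ≡⟨ cong ℤ.-_ (sym (μ-unfold n)) ⟩
  ℤ.- μ n                                                           ∎
  where
  open ≡-Reasoning
  negate-branch : ∀ b → (if b then ℤ.- sign (length (primeDivisors n)) else + 0) ≡ ℤ.- (if b then sign (length (primeDivisors n)) else + 0)
  negate-branch true  = refl
  negate-branch false = refl

μ[p*n]≡0 : ∀ {p n} → Prime p → 1 ≤ n → p ∣ n → μ (p * n) ≡ + 0
μ[p*n]≡0 {p} {n} p-prime 1≤n p∣n with squareFree (p * n) in sf≡ | μ-unfold (p * n)
... | false | μ≡ = μ≡
... | true  | _  = ⊥-elim (squareFree⁻ (*-mono-≤ (prime⇒≥1 p-prime) 1≤n) (subst T (sym sf≡) tt) p p-prime (*-monoʳ-∣ p p∣n))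

-- Möbius sums over divisors

∑μ : List ℕ → (ℕ → ℚ) → ℚ
∑μ []      F = F 1
∑μ (p ∷ Q) F = ∑μ Q F ℚ.- ∑μ Q (λ b → F (p * b))

∑μ-cong : ∀ Q {F G : ℕ → ℚ} → (∀ a → F a ≡ G a) → ∑μ Q F ≡ ∑μ Q G
∑μ-cong []      F≗G = F≗G 1
∑μ-cong (p ∷ Q) F≗G = cong₂ ℚ._-_ (∑μ-cong Q F≗G) (∑μ-cong Q (F≗G ∘ (p *_)))

∑μ-*ˡ : ∀ Q c (F : ℕ → ℚ) → ∑μ Q (λ a → c ℚ.* F a) ≡ c ℚ.* ∑μ Q F
∑μ-*ˡ []      c F = refl
∑μ-*ˡ (p ∷ Q) c F = begin
  ∑μ Q (λ a → c ℚ.* F a) ℚ.- ∑μ Q (λ b → c ℚ.* F (p * b)) ≡⟨ cong₂ ℚ._-_ (∑μ-*ˡ Q c F) (∑μ-*ˡ Q c (F ∘ (p *_))) ⟩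
  c ℚ.* ∑μ Q F ℚ.- c ℚ.* ∑μ Q (F ∘ (p *_))               ≡⟨ *-distribˡ-- c (∑μ Q F) (∑μ Q (F ∘ (p *_))) ⟩
  c ℚ.* (∑μ Q F ℚ.- ∑μ Q (F ∘ (p *_)))                    ∎
  where open ≡-Reasoning

μ-divisor-term-p* : ∀ {p m} → Prime p → p ∤ m → (F : ℕ → ℚ) → ∀ j → 1 ≤ j →
                    when (divides (p * j) (p * m)) (ιℤ (μ (p * j)) ℚ.* F (p * j)) ≡ ℚ.- when (divides j m) (ιℤ (μ j) ℚ.* F (p * j))
μ-divisor-term-p* {p} {m} p-prime p∤m F j 1≤j = trans (cong (λ b → when b _) pj∣pm≡j∣m) (by-cases (p ∣? j))
  where
  open ≡-Reasoning
  pj∣pm≡j∣m : divides (p * j) (p * m) ≡ divides j m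
  pj∣pm≡j∣m = does-⇔ (mk⇔ (*-cancelˡ-∣ p {{prime⇒nonZero p-prime}}) (*-monoʳ-∣ p)) (p * j ∣? p * m) (j ∣? m)
  by-cases : Dec (p ∣ j) → when (divides j m) (ιℤ (μ (p * j)) ℚ.* F (p * j)) ≡ ℚ.- when (divides j m) (ιℤ (μ j) ℚ.* F (p * j))
  by-cases (yes p∣j) = trans (when-no (j ∣? m) j∤m) (cong ℚ.-_ (sym (when-no (j ∣? m) j∤m)))
    where
    j∤m : j ∤ m
    j∤m j∣m = p∤m (∣-trans p∣j j∣m)
  by-cases (no p∤j) = begin
    when (divides j m) (ιℤ (μ (p * j)) ℚ.* F (p * j))
      ≡⟨ cong (λ z → when (divides j m) (z ℚ.* F (p * j))) (trans (cong ιℤ (μ[p*n]≡-μ[n] p-prime 1≤j p∤j)) (ιℤ-neg (μ j))) ⟩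
    when (divides j m) (ℚ.- ιℤ (μ j) ℚ.* F (p * j))   ≡⟨ cong (when (divides j m)) (sym (ℚP.neg-distribˡ-* (ιℤ (μ j)) (F (p * j)))) ⟩
    when (divides j m) (ℚ.- (ιℤ (μ j) ℚ.* F (p * j))) ≡⟨ when-homo ℚ.-_ refl (divides j m) _ ⟩
    ℚ.- when (divides j m) (ιℤ (μ j) ℚ.* F (p * j))   ∎

coprime-divisor-indicator : ∀ {p m} → Prime p → p ∤ m → (G : ℕ → ℚ) → ∀ a → 1 ≤ a →
                            when (not (divides p a)) (when (divides a (p * m)) (G a)) ≡ when (divides a m) (G a)
coprime-divisor-indicator {p} {m} p-prime p∤m G a 1≤a with p ∣? a
... | yes p∣a = sym (when-no (a ∣? m) (λ a∣m → p∤m (∣-trans p∣a a∣m)))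
... | no  p∤a = cong (λ b → when b (G a)) (does-⇔ (mk⇔ (coprime-divisor (prime∤⇒coprime p-prime 1≤a p∤a)) (∣n⇒∣m*n p)) (a ∣? p * m) (a ∣? m))

∑-μ-divisors : ∀ {Q} → DistinctPrimes Q → ∀ n → product Q ≤ n → (F : ℕ → ℚ) →
               ∑ n (λ a → when (divides a (product Q)) (ιℤ (μ a) ℚ.* F a)) ≡ ∑μ Q F
∑-μ-divisors [] n 1≤n F = trans (∑-single n 1 (s≤s z≤n) 1≤n (λ k k≢1 → when-no (k ∣? 1) (k≢1 ∘ ∣1⇒≡1))) (ℚP.*-identityˡ (F 1))
∑-μ-divisors {p ∷ Q} (cons p-prime p∉Q Q-primes) n pm≤n F = begin
  ∑ n term
    ≡⟨ ∑-split n (divides p) term ⟩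
  ∑ n (λ a → when (divides p a) (term a)) ℚ.+ ∑ n (λ a → when (not (divides p a)) (term a))
    ≡⟨ cong₂ ℚ._+_ (trans (∑-multiples p n term) (∑-cong (n / p) (λ j 1≤j _ → μ-divisor-term-p* p-prime p∤m F j 1≤j)))
                   (∑-cong n (λ a 1≤a _ → coprime-divisor-indicator p-prime p∤m (λ a → ιℤ (μ a) ℚ.* F a) a 1≤a)) ⟩
  ∑ (n / p) (λ j → ℚ.- when (divides j m) (ιℤ (μ j) ℚ.* F (p * j))) ℚ.+ ∑ n (λ a → when (divides a m) (ιℤ (μ a) ℚ.* F a))
    ≡⟨ cong₂ ℚ._+_ (trans (∑-neg (n / p) _) (cong ℚ.-_ (∑-μ-divisors Q-primes (n / p) m≤n/p (F ∘ (p *_))))) (∑-μ-divisors Q-primes n m≤n F) ⟩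
  ℚ.- ∑μ Q (F ∘ (p *_)) ℚ.+ ∑μ Q F
    ≡⟨ ℚP.+-comm (ℚ.- ∑μ Q (F ∘ (p *_))) (∑μ Q F) ⟩
  ∑μ (p ∷ Q) F ∎
  where
  open ≡-Reasoning
  instance
    p-nonZero : NonZero p
    p-nonZero = prime⇒nonZero p-prime
  m : ℕ
  m = product Q
  term : ℕ → ℚ
  term a = when (divides a (p * m)) (ιℤ (μ a) ℚ.* F a)
  p∤m : p ∤ m
  p∤m p∣m = p∉Q (prime∣product⇒∈ Q-primes p-prime p∣m)
  m≤n : m ≤ n
  m≤n = ≤-trans (m≤n*m m p) pm≤n
  m≤n/p : m ≤ n / p
  m≤n/p = subst (_≤ n / p) (trans (cong (_/ p) (*-comm p m)) (m*n/n≡m m p)) (Data.Nat.DivMod./-monoˡ-≤ p pm≤n)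

μ≢0⇒∣product : ∀ {Q} → DistinctPrimes Q → ∀ a → 1 ≤ a → μ a ≢ + 0 → ComposedOf Q a → a ∣ product Q
μ≢0⇒∣product {Q} Q-primes = <-rec _ step
  where
  step : ∀ a → (∀ {b} → b < a → 1 ≤ b → μ b ≢ + 0 → ComposedOf Q b → b ∣ product Q) →
         1 ≤ a → μ a ≢ + 0 → ComposedOf Q a → a ∣ product Q
  step a rec 1≤a μa≢0 a∈Q with a ≟ 1
  ... | yes refl = 1∣ _
  ... | no  a≢1 with primeFactor a (≤∧≢⇒< 1≤a (a≢1 ∘ sym))
  ...   | q , q-prime , q∣a@(Data.Nat.Divisibility.divides b a≡b*q) =
          subst (_∣ product Q) (sym a≡q*b) (coprime⇒*∣ q⊥b (∈⇒∣product (a∈Q q q-prime q∣a)) b∣ΠQ)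
    where
    a≡q*b : a ≡ q * b
    a≡q*b = trans a≡b*q (*-comm b q)
    1≤b : 1 ≤ b
    1≤b = ≢0⇒≥1 (λ { refl → <-irrefl (sym (trans a≡q*b (*-zeroʳ q))) 1≤a })
    q∤b : q ∤ b
    q∤b q∣b = μa≢0 (trans (cong μ a≡q*b) (μ[p*n]≡0 q-prime 1≤b q∣b))
    q⊥b : Coprime q b
    q⊥b = Data.Nat.Coprimality.sym (prime∤⇒coprime q-prime 1≤b q∤b)
    b<a : b < a
    b<a = subst (b <_) (sym a≡b*q) (m<m*n b q {{ℕ.>-nonZero 1≤b}} (prime⇒≥2 q-prime))
    b∣ΠQ : b ∣ product Q
    b∣ΠQ = rec b<a 1≤b (λ μb≡0 → μa≢0 (trans (cong μ a≡q*b) (trans (μ[p*n]≡-μ[n] q-prime 1≤b q∤b) (cong ℤ.-_ μb≡0))))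
               (λ r r-prime r∣b → a∈Q r r-prime (∣-trans r∣b (subst (b ∣_) (sym a≡q*b) (n∣m*n q))))

sum-divisorsOf-μ : ∀ d → 1 ≤ d → (F : ℕ → ℚ) →
                   ℚsum (map (λ a → ιℤ (μ a) ℚ.* F a) (divisorsOf d)) ≡ ∑μ (primeDivisors d) F
sum-divisorsOf-μ d 1≤d F = begin
  ℚsum (map (λ a → ιℤ (μ a) ℚ.* F a) (divisorsOf d))                 ≡⟨ sum-filterᵇ (λ a → divides a d) _ (range1 d) ⟩
  ℚsum (map (λ a → when (divides a d) (ιℤ (μ a) ℚ.* F a)) (range1 d)) ≡⟨ sum-range1 _ d ⟩
  ∑ d (λ a → when (divides a d) (ιℤ (μ a) ℚ.* F a))                   ≡⟨ ∑-cong d (λ a 1≤a _ → squareFree-part a 1≤a) ⟩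
  ∑ d (λ a → when (divides a (rad d)) (ιℤ (μ a) ℚ.* F a))             ≡⟨ ∑-μ-divisors Q-primes d (∣⇒≤ {{ℕ.>-nonZero 1≤d}} (rad∣ d)) F ⟩
  ∑μ (primeDivisors d) F                                              ∎
  where
  open ≡-Reasoning
  Q-primes : DistinctPrimes (primeDivisors d)
  Q-primes = primeDivisors-distinct d
  squareFree-part : ∀ a → 1 ≤ a → when (divides a d) (ιℤ (μ a) ℚ.* F a) ≡ when (divides a (rad d)) (ιℤ (μ a) ℚ.* F a)
  squareFree-part a 1≤a with μ a ℤ.≟ + 0
  ... | yes μa≡0 = trans (cong (when _) zero-term) (trans (when-ε _) (sym (trans (cong (when _) zero-term) (when-ε _))))
    where
    zero-term : ιℤ (μ a) ℚ.* F a ≡ 0ℚ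
    zero-term = trans (cong (λ z → ιℤ z ℚ.* F a) μa≡0) (ℚP.*-zeroˡ (F a))
  ... | no  μa≢0 = cong (λ b → when b _) (does-⇔ (mk⇔ to (λ a∣rad → ∣-trans a∣rad (rad∣ d))) (a ∣? d) (a ∣? rad d))
    where
    to : a ∣ d → a ∣ rad d
    to a∣d = μ≢0⇒∣product Q-primes a 1≤a μa≢0 (λ q q-prime q∣a → ∈-primeDivisors⁺ 1≤d q-prime (∣-trans q∣a a∣d))

-- The gcd factor (αv, h)

gcd[m*n,k]∣m*gcd[n,k] : ∀ m n k → gcd (m * n) k ∣ m * gcd n k
gcd[m*n,k]∣m*gcd[n,k] m n k = subst (gcd (m * n) k ∣_) (sym (c*gcd[m,n]≡gcd[cm,cn] m n k))
  (gcd-greatest (gcd[m,n]∣m (m * n) k) (∣-trans (gcd[m,n]∣n (m * n) k) (n∣m*n m)))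

gcd[n,k]∣gcd[m*n,k] : ∀ m n k → gcd n k ∣ gcd (m * n) k
gcd[n,k]∣gcd[m*n,k] m n k = gcd-greatest (∣-trans (gcd[m,n]∣m n k) (n∣m*n m)) (gcd[m,n]∣n n k)

gcd[m*n,k]≡m*gcd[n,k] : ∀ m n k → m * gcd n k ∣ k → gcd (m * n) k ≡ m * gcd n k
gcd[m*n,k]≡m*gcd[n,k] m n k m*g∣k = ∣-antisym (gcd[m*n,k]∣m*gcd[n,k] m n k) (gcd-greatest (*-monoʳ-∣ m (gcd[m,n]∣m n k)) m*g∣k)

gcd[p*n,k]≡gcd[n,k] : ∀ {p} n k → Prime p → 1 ≤ k → p * gcd n k ∤ k → gcd (p * n) k ≡ gcd n k
gcd[p*n,k]≡gcd[n,k] {p} n k p-prime 1≤k p*g∤k with gcd[n,k]∣gcd[m*n,k] p n k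
... | Data.Nat.Divisibility.divides t G≡t*g with prime⇒irreducible p-prime t∣p
  where
  g≥1 : 1 ≤ gcd n k
  g≥1 = ∣≥1⇒≥1 1≤k (gcd[m,n]∣n n k)
  t∣p : t ∣ p
  t∣p = Data.Nat.Divisibility.*-cancelʳ-∣ (gcd n k) {{ℕ.>-nonZero g≥1}} (subst (_∣ p * gcd n k) G≡t*g (gcd[m*n,k]∣m*gcd[n,k] p n k))
... | inj₁ refl = trans G≡t*g (*-identityˡ _)
... | inj₂ refl = ⊥-elim (p*g∤k (subst (_∣ k) G≡t*g (gcd[m,n]∣n (p * n) k)))

coprime⇒*-∣ : ∀ {p q g k} → Coprime q p → 1 ≤ g → q * g ∣ k → p * g ∣ k → q * (p * g) ∣ k
coprime⇒*-∣ {p} {q} {g} {k} q⊥p 1≤g q*g∣k p*g∣k with ∣-trans (n∣m*n q) q*g∣k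
... | Data.Nat.Divisibility.divides k′ k≡k′*g =
  subst (q * (p * g) ∣_) (sym k≡k′*g) (subst (_∣ k′ * g) (*-assoc q p g) (*-monoˡ-∣ g (coprime⇒*∣ q⊥p (cancel q*g∣k) (cancel p*g∣k))))
  where
  cancel : ∀ {r} → r * g ∣ k → r ∣ k′
  cancel r*g∣k = Data.Nat.Divisibility.*-cancelʳ-∣ g {{ℕ.>-nonZero 1≤g}} (subst (_ ∣_) k≡k′*g r*g∣k)

Φ : List ℕ → ℚ
Φ Q = ℚprod (map (λ p → 1ℚ ℚ.- 1/ι p) Q)

Φ≡ : ∀ {Q} → DistinctPrimes Q → Φ Q ≡ ι (product (map (_∸ 1) Q)) ℚ.* 1/ι (product Q)
Φ≡ []                          = refl
Φ≡ {p ∷ Q} (cons p-prime _ Q-primes) = begin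
  (1ℚ ℚ.- 1/ι p) ℚ.* Φ Q                               ≡⟨ cong₂ ℚ._*_ (1-1/ι≡ (prime⇒≥1 p-prime)) (Φ≡ Q-primes) ⟩
  ι (p ∸ 1) ℚ.* 1/ι p ℚ.* (ι A ℚ.* 1/ι (product Q))    ≡⟨ ℚ*.interchange (ι (p ∸ 1)) (1/ι p) (ι A) (1/ι (product Q)) ⟩
  ι (p ∸ 1) ℚ.* ι A ℚ.* (1/ι p ℚ.* 1/ι (product Q))    ≡⟨ cong₂ ℚ._*_ (sym (ι-* (p ∸ 1) A)) (sym (1/ι-* p (product Q))) ⟩
  ι ((p ∸ 1) * A) ℚ.* 1/ι (p * product Q)              ∎
  where
  open ≡-Reasoning
  A : ℕ
  A = product (map (_∸ 1) Q)

product-pred≥1 : ∀ {Q} → DistinctPrimes Q → 1 ≤ product (map (_∸ 1) Q)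
product-pred≥1 []                        = s≤s z≤n
product-pred≥1 (cons p-prime _ Q-primes) = *-mono-≤ (∸-monoˡ-≤ 1 (prime⇒≥2 p-prime)) (product-pred≥1 Q-primes)

module GcdSum (h : ℕ) (1≤h : 1 ≤ h) where

  -- p * (v, h) ∣ h  iff  ν_p(v) < ν_p(h)
  Deficient : ℕ → ℕ → Set
  Deficient v p = p * gcd v h ∣ h

  gcdTerm : ℕ → ℕ → ℚ
  gcdTerm v a = ι (gcd (a * v) h) ℚ.* 1/ι a

  gcd≥1 : ∀ v → 1 ≤ gcd v h
  gcd≥1 v = ∣≥1⇒≥1 1≤h (gcd[m,n]∣n v h)

  gcdTerm-p* : ∀ p v b → gcdTerm v (p * b) ≡ 1/ι p ℚ.* gcdTerm (p * v) b
  gcdTerm-p* p v b = begin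
    ι (gcd (p * b * v) h) ℚ.* 1/ι (p * b)           ≡⟨ cong₂ (λ n x → ι (gcd n h) ℚ.* x) (reassoc p b v) (1/ι-* p b) ⟩
    ι (gcd (b * (p * v)) h) ℚ.* (1/ι p ℚ.* 1/ι b)   ≡⟨ ℚ*.x∙yz≈y∙xz (ι (gcd (b * (p * v)) h)) (1/ι p) (1/ι b) ⟩
    1/ι p ℚ.* (ι (gcd (b * (p * v)) h) ℚ.* 1/ι b)   ∎
    where
    open ≡-Reasoning
    reassoc : ∀ p b v → p * b * v ≡ b * (p * v)
    reassoc = solve-∀

  ∑μ-gcdTerm-∷ : ∀ p Q v → ∑μ (p ∷ Q) (gcdTerm v) ≡ ∑μ Q (gcdTerm v) ℚ.- 1/ι p ℚ.* ∑μ Q (gcdTerm (p * v))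
  ∑μ-gcdTerm-∷ p Q v = cong (λ x → ∑μ Q (gcdTerm v) ℚ.- x) (trans (∑μ-cong Q (gcdTerm-p* p v)) (∑μ-*ˡ Q (1/ι p) (gcdTerm (p * v))))

  deficient-p* : ∀ {p Q v} → Prime p → p ∉ Q → DistinctPrimes Q → Any (Deficient v) Q → Any (Deficient (p * v)) Q
  deficient-p* {p} {Q} {v} p-prime p∉Q Q-primes Q-def with p * gcd v h ∣? h
  ... | no  p*g∤h = Any.map (λ {q} → subst (λ g → q * g ∣ h) (sym (gcd[p*n,k]≡gcd[n,k] v h p-prime 1≤h p*g∤h))) Q-def
  ... | yes p*g∣h = raise p∉Q Q-primes Q-def
    where
    raise : ∀ {Q} → p ∉ Q → DistinctPrimes Q → Any (Deficient v) Q → Any (Deficient (p * v)) Q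
    raise {q ∷ _} p∉ (cons q-prime _ _) (here q*g∣h) = here (subst (λ g → q * g ∣ h) (sym (gcd[m*n,k]≡m*gcd[n,k] p v h p*g∣h))
      (coprime⇒*-∣ (distinctPrimes⇒coprime q-prime p-prime (p∉ ∘ here ∘ sym)) (gcd≥1 v) q*g∣h p*g∣h))
    raise p∉ (cons _ _ Q-primes) (there Q-def) = there (raise (p∉ ∘ there) Q-primes Q-def)

  ∑μ-gcdTerm-sufficient : ∀ {Q} → DistinctPrimes Q → ∀ v → ¬ Any (Deficient v) Q → ∑μ Q (gcdTerm v) ≡ ι (gcd v h) ℚ.* Φ Q
  ∑μ-gcdTerm-sufficient [] v _ = cong (λ n → ι (gcd n h) ℚ.* 1ℚ) (*-identityˡ v)
  ∑μ-gcdTerm-sufficient {p ∷ Q} (cons p-prime _ Q-primes) v none = begin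
    ∑μ (p ∷ Q) (gcdTerm v)                                 ≡⟨ ∑μ-gcdTerm-∷ p Q v ⟩
    ∑μ Q (gcdTerm v) ℚ.- 1/ι p ℚ.* ∑μ Q (gcdTerm (p * v))
      ≡⟨ cong₂ (λ x y → x ℚ.- 1/ι p ℚ.* y) (∑μ-gcdTerm-sufficient Q-primes v (none ∘ there))
               (trans (∑μ-gcdTerm-sufficient Q-primes (p * v) none′) (cong (λ n → ι n ℚ.* Φ Q) G≡g)) ⟩
    ι g ℚ.* Φ Q ℚ.- 1/ι p ℚ.* (ι g ℚ.* Φ Q)                ≡⟨ factor (ι g) (Φ Q) (1/ι p) ⟩
    ι g ℚ.* ((1ℚ ℚ.- 1/ι p) ℚ.* Φ Q)                       ∎
    where
    open ≡-Reasoning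
    g : ℕ
    g = gcd v h
    G≡g : gcd (p * v) h ≡ g
    G≡g = gcd[p*n,k]≡gcd[n,k] v h p-prime 1≤h (none ∘ here)
    none′ : ¬ Any (Deficient (p * v)) Q
    none′ = none ∘ there ∘ Any.map (λ {q} → subst (λ g → q * g ∣ h) G≡g)
    factor : ∀ x y r → x ℚ.* y ℚ.- r ℚ.* (x ℚ.* y) ≡ x ℚ.* ((1ℚ ℚ.- r) ℚ.* y)
    factor = RingSolver.solve-∀ ℚ-ring

  ∑μ-gcdTerm-deficient : ∀ {Q} → DistinctPrimes Q → ∀ v → Any (Deficient v) Q → ∑μ Q (gcdTerm v) ≡ 0ℚ
  ∑μ-gcdTerm-deficient {p ∷ Q} (cons p-prime p∉Q Q-primes) v p∷Q-def = trans (∑μ-gcdTerm-∷ p Q v) (cancel p∷Q-def)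
    where
    g : ℕ
    g = gcd v h
    both-zero : ∀ {x y} r → x ≡ 0ℚ → y ≡ 0ℚ → x ℚ.- r ℚ.* y ≡ 0ℚ
    both-zero r refl refl = cong (λ y → 0ℚ ℚ.- y) (ℚP.*-zeroʳ r)
    by-induction : Any (Deficient v) Q → ∑μ Q (gcdTerm v) ℚ.- 1/ι p ℚ.* ∑μ Q (gcdTerm (p * v)) ≡ 0ℚ
    by-induction Q-def = both-zero (1/ι p) (∑μ-gcdTerm-deficient Q-primes v Q-def)
                           (∑μ-gcdTerm-deficient Q-primes (p * v) (deficient-p* p-prime p∉Q Q-primes Q-def))
    cancel : Any (Deficient v) (p ∷ Q) → ∑μ Q (gcdTerm v) ℚ.- 1/ι p ℚ.* ∑μ Q (gcdTerm (p * v)) ≡ 0ℚ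
    cancel (there Q-def) = by-induction Q-def
    cancel (here p*g∣h) with Any.any? (λ q → q * g ∣? h) Q
    ... | yes Q-def = by-induction Q-def
    ... | no  none  = begin
      ∑μ Q (gcdTerm v) ℚ.- 1/ι p ℚ.* ∑μ Q (gcdTerm (p * v))
        ≡⟨ cong₂ (λ x y → x ℚ.- 1/ι p ℚ.* y) (∑μ-gcdTerm-sufficient Q-primes v none)
                 (trans (∑μ-gcdTerm-sufficient Q-primes (p * v) none′) (cong (λ n → ι n ℚ.* Φ Q) G≡p*g)) ⟩
      ι g ℚ.* Φ Q ℚ.- 1/ι p ℚ.* (ι (p * g) ℚ.* Φ Q)       ≡⟨ cong (λ x → ι g ℚ.* Φ Q ℚ.- 1/ι p ℚ.* (x ℚ.* Φ Q)) (ι-* p g) ⟩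
      ι g ℚ.* Φ Q ℚ.- 1/ι p ℚ.* (ι p ℚ.* ι g ℚ.* Φ Q)     ≡⟨ factor (ι g) (Φ Q) (1/ι p) (ι p) ⟩
      ι g ℚ.* Φ Q ℚ.* (1ℚ ℚ.- ι p ℚ.* 1/ι p)              ≡⟨ cong (λ x → ι g ℚ.* Φ Q ℚ.* (1ℚ ℚ.- x)) (ι*1/ι≡1 (prime⇒≥1 p-prime)) ⟩
      ι g ℚ.* Φ Q ℚ.* (1ℚ ℚ.- 1ℚ)                         ≡⟨ ℚP.*-zeroʳ (ι g ℚ.* Φ Q) ⟩
      0ℚ                                                  ∎
      where
      open ≡-Reasoning
      G≡p*g : gcd (p * v) h ≡ p * g
      G≡p*g = gcd[m*n,k]≡m*gcd[n,k] p v h p*g∣h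
      none′ : ¬ Any (Deficient (p * v)) Q
      none′ = none ∘ Any.map (λ {q} → ∣-trans (*-monoʳ-∣ q (gcd[n,k]∣gcd[m*n,k] p v h)))
      factor : ∀ x y r s → x ℚ.* y ℚ.- r ℚ.* (s ℚ.* x ℚ.* y) ≡ x ℚ.* y ℚ.* (1ℚ ℚ.- s ℚ.* r)
      factor = RingSolver.solve-∀ ℚ-ring

-- Euler's totient

coprimeToAllᵇ : List ℕ → ℕ → Bool
coprimeToAllᵇ Q k = foldr (λ q b → not (divides q k) ∧ b) true Q

sieveCount : List ℕ → ℕ → ℕ
sieveCount Q n = ℕΣ.∑ n (λ k → ℕΣ.when (coprimeToAllᵇ Q k) 1)

coprimeToAllᵇ-p* : ∀ {p Q} → Prime p → p ∉ Q → DistinctPrimes Q → ∀ j → coprimeToAllᵇ Q (p * j) ≡ coprimeToAllᵇ Q j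
coprimeToAllᵇ-p*             p-prime p∉Q []                        j = refl
coprimeToAllᵇ-p* {p} {q ∷ Q} p-prime p∉Q (cons q-prime _ Q-primes) j =
  cong₂ (λ a b → not a ∧ b) (does-⇔ (mk⇔ to (∣n⇒∣m*n p)) (q ∣? p * j) (q ∣? j)) (coprimeToAllᵇ-p* p-prime (p∉Q ∘ there) Q-primes j)
  where
  to : q ∣ p * j → q ∣ j
  to q∣pj with euclidsLemma p j q-prime q∣pj
  ... | inj₁ q∣p = ⊥-elim (p∉Q (here (sym (prime∣prime⇒≡ p-prime q-prime q∣p))))
  ... | inj₂ q∣j = q∣j

sieveCount-∷ : ∀ {p Q} .{{_ : NonZero p}} → Prime p → p ∉ Q → DistinctPrimes Q → ∀ n → sieveCount (p ∷ Q) n + sieveCount Q (n / p) ≡ sieveCount Q n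
sieveCount-∷ {p} {Q} p-prime p∉Q Q-primes n = begin
  sieveCount (p ∷ Q) n + sieveCount Q (n / p)  ≡⟨ +-comm (sieveCount (p ∷ Q) n) _ ⟩
  sieveCount Q (n / p) + sieveCount (p ∷ Q) n
    ≡⟨ cong₂ _+_ (ℕΣ.∑-cong (n / p) (λ j _ _ → cong (λ b → ℕΣ.when b 1) (sym (coprimeToAllᵇ-p* p-prime p∉Q Q-primes j))))
                 (ℕΣ.∑-cong n (λ k _ _ → nested-when (divides p k) (coprimeToAllᵇ Q k))) ⟩
  ℕΣ.∑ (n / p) (λ j → indicator (p * j)) + ℕΣ.∑ n (λ k → ℕΣ.when (not (divides p k)) (indicator k))
    ≡⟨ cong (_+ ℕΣ.∑ n (λ k → ℕΣ.when (not (divides p k)) (indicator k))) (sym (ℕΣ.∑-multiples p n indicator)) ⟩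
  ℕΣ.∑ n (λ k → ℕΣ.when (divides p k) (indicator k)) + ℕΣ.∑ n (λ k → ℕΣ.when (not (divides p k)) (indicator k))
    ≡⟨ sym (ℕΣ.∑-split n (divides p) indicator) ⟩
  sieveCount Q n ∎
  where
  open ≡-Reasoning
  indicator : ℕ → ℕ
  indicator k = ℕΣ.when (coprimeToAllᵇ Q k) 1
  nested-when : ∀ b c → ℕΣ.when (not b ∧ c) 1 ≡ ℕΣ.when (not b) (ℕΣ.when c 1)
  nested-when true  c = refl
  nested-when false c = refl

sieveCount-product : ∀ {Q} → DistinctPrimes Q → ∀ n → product Q ∣ n → sieveCount Q n * product Q ≡ n * product (map (_∸ 1) Q)
sieveCount-product []                     n _ = trans (*-identityʳ _) (trans (count-all n) (sym (*-identityʳ n)))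
  where
  count-all : ∀ n → sieveCount [] n ≡ n
  count-all zero    = refl
  count-all (suc n) = trans (cong (_+ 1) (count-all n)) (+-comm n 1)
sieveCount-product {p ∷ Q} (cons p-prime p∉Q Q-primes) n p*ΠQ∣n = +-cancelʳ-≡ (n * Aq) _ _ (begin
  C * (p * B) + n * Aq             ≡⟨ cong (λ m → C * (p * B) + m * Aq) (sym p*[n/p]≡n) ⟩
  C * (p * B) + p * (n / p) * Aq   ≡⟨ cong (λ m → C * (p * B) + m) (trans (*-assoc p (n / p) Aq) (cong (p *_) (sym IH[n/p]))) ⟩
  C * (p * B) + p * (C′ * B)       ≡⟨ regroup C p B C′ ⟩
  p * (C + C′) * B                 ≡⟨ cong (λ m → p * m * B) (sieveCount-∷ p-prime p∉Q Q-primes n) ⟩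
  p * sieveCount Q n * B           ≡⟨ trans (*-assoc p _ B) (cong (p *_) IH[n]) ⟩
  p * (n * Aq)                     ≡⟨ cong (λ q → q * (n * Aq)) (sym (m∸n+n≡m (prime⇒≥1 p-prime))) ⟩
  (p ∸ 1 + 1) * (n * Aq)           ≡⟨ expand (p ∸ 1) n Aq ⟩
  n * ((p ∸ 1) * Aq) + n * Aq      ∎)
  where
  open ≡-Reasoning
  instance
    p-nonZero : NonZero p
    p-nonZero = prime⇒nonZero p-prime
  B Aq C C′ : ℕ
  B  = product Q
  Aq = product (map (_∸ 1) Q)
  C  = sieveCount (p ∷ Q) n
  C′ = sieveCount Q (n / p)
  p*[n/p]≡n : p * (n / p) ≡ n
  p*[n/p]≡n = Data.Nat.DivMod.m*[n/m]≡n (∣-trans (m∣m*n B) p*ΠQ∣n)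
  IH[n] : sieveCount Q n * B ≡ n * Aq
  IH[n] = sieveCount-product Q-primes n (∣-trans (n∣m*n p) p*ΠQ∣n)
  IH[n/p] : C′ * B ≡ n / p * Aq
  IH[n/p] = sieveCount-product Q-primes (n / p) (*-cancelˡ-∣ p (subst (p * B ∣_) (sym p*[n/p]≡n) p*ΠQ∣n))
  regroup : ∀ x p b y → x * (p * b) + p * (y * b) ≡ p * (x + y) * b
  regroup = solve-∀
  expand : ∀ p′ n a → (p′ + 1) * (n * a) ≡ n * (p′ * a) + n * a
  expand = solve-∀

φ≡sieveCount : ∀ {Q} n → 1 ≤ n → DistinctPrimes Q → ComposedOf Q n → (∀ {q} → q ∈ Q → q ∣ n) → φ n ≡ sieveCount Q n
φ≡sieveCount {Q} n 1≤n Q-primes n∈Q Q∣n = trans (length-filterᵇ _ n) (ℕΣ.∑-cong n (λ k 1≤k _ → cong (λ b → ℕΣ.when b 1) (T-ext (to k) (from k 1≤k))))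
  where
  to : ∀ k → T (does (gcd k n ≟ 1)) → T (coprimeToAllᵇ Q k)
  to k gcd≡1 = T-all⁺ (λ q → not (divides q k)) Q λ {q} q∈Q → T-not-does (q ∣? k) λ q∣k →
    ¬prime[1] (subst Prime (∣1⇒≡1 (subst (q ∣_) (T-does⁻¹ (gcd k n ≟ 1) gcd≡1) (gcd-greatest q∣k (Q∣n q∈Q)))) (∈-distinctPrimes⇒prime Q-primes q∈Q))
  from : ∀ k → 1 ≤ k → T (coprimeToAllᵇ Q k) → T (does (gcd k n ≟ 1))
  from k 1≤k k⊥Q = T-does (gcd k n ≟ 1) (coprime⇒gcd≡1 (noCommonPrime⇒coprime 1≤k λ r r-prime r∣k r∣n →
    T-not-does⁻¹ (r ∣? k) (T-all⁻ (λ q → not (divides q k)) Q k⊥Q (n∈Q r r-prime r∣n)) r∣k))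

-- The d-part of h

foldr-⊔-sel : ∀ xs → foldr _⊔_ 0 xs ≡ 0 ⊎ foldr _⊔_ 0 xs ∈ xs
foldr-⊔-sel []       = inj₁ refl
foldr-⊔-sel (x ∷ xs) with ⊔-sel x (foldr _⊔_ 0 xs)
... | inj₁ max≡x = inj₂ (here max≡x)
... | inj₂ max≡m with foldr-⊔-sel xs
...   | inj₁ m≡0 = inj₁ (trans max≡m m≡0)
...   | inj₂ m∈xs = inj₂ (there (subst (_∈ xs) (sym max≡m) m∈xs))

∈⇒≤foldr-⊔ : ∀ {x xs} → x ∈ xs → x ≤ foldr _⊔_ 0 xs
∈⇒≤foldr-⊔ {x} {y ∷ xs} (here refl) = m≤m⊔n x _
∈⇒≤foldr-⊔ {x} {y ∷ xs} (there x∈) = ≤-trans (∈⇒≤foldr-⊔ x∈) (m≤n⊔m y _)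

n<m^n : ∀ {m} → 2 ≤ m → ∀ n → n < m ^ n
n<m^n 2≤m zero    = s≤s z≤n
n<m^n {m} 2≤m (suc n) = begin-strict
  suc n               ≤⟨ n<m^n 2≤m n ⟩
  m ^ n               <⟨ m<m+n (m ^ n) (m^n>0 m {{ℕ.>-nonZero (≤-trans (s≤s z≤n) 2≤m)}} n) ⟩
  m ^ n + m ^ n       ≡⟨ cong (λ k → m ^ n + k) (sym (+-identityʳ (m ^ n))) ⟩
  2 * m ^ n           ≤⟨ *-monoˡ-≤ (m ^ n) 2≤m ⟩
  m * m ^ n           ∎
  where open ≤-Reasoning

module HPart (h : ℕ) (1≤h : 1 ≤ h) where

  p^ν∣h : ∀ p → p ^ ν p h ∣ h
  p^ν∣h p with foldr-⊔-sel (filterᵇ (λ k → divides (p ^ k) h) (range1 h))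
  ... | inj₁ ν≡0  = subst (λ k → p ^ k ∣ h) (sym ν≡0) (1∣ h)
  ... | inj₂ ν∈ = T-does⁻¹ (p ^ ν p h ∣? h) (proj₂ (∈-filterᵇ⁻ (λ k → divides (p ^ k) h) {xs = range1 h} ν∈))

  p^[1+ν]∤h : ∀ {p} → 2 ≤ p → p ^ suc (ν p h) ∤ h
  p^[1+ν]∤h {p} 2≤p p^[1+ν]∣h = 1+n≰n (∈⇒≤foldr-⊔ (∈-filterᵇ⁺ (λ k → divides (p ^ k) h)
    (∈-range1⁺ (s≤s z≤n) 1+ν≤h) (T-does (p ^ suc (ν p h) ∣? h) p^[1+ν]∣h)))
    where
    1+ν≤h : suc (ν p h) ≤ h
    1+ν≤h = <⇒≤ (<-≤-trans (n<m^n 2≤p (suc (ν p h))) (∣⇒≤ {{ℕ.>-nonZero 1≤h}} p^[1+ν]∣h))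

  hPart : List ℕ → ℕ
  hPart Q = product (map (λ p → p ^ ν p h) Q)

  hPart≥1 : ∀ {Q} → DistinctPrimes Q → 1 ≤ hPart Q
  hPart≥1 []                        = s≤s z≤n
  hPart≥1 {p ∷ Q} (cons p-prime _ Q-primes) = *-mono-≤ (m^n>0 p {{prime⇒nonZero p-prime}} (ν p h)) (hPart≥1 Q-primes)

  hPart-composedOf : ∀ {Q} → DistinctPrimes Q → ComposedOf Q (hPart Q)
  hPart-composedOf [] q q-prime q∣1 = ⊥-elim (¬prime[1] (subst Prime (∣1⇒≡1 q∣1) q-prime))
  hPart-composedOf {p ∷ Q} (cons p-prime _ Q-primes) q q-prime q∣ with euclidsLemma (p ^ ν p h) (hPart Q) q-prime q∣
  ... | inj₁ q∣p^ν = here (prime∣prime⇒≡ p-prime q-prime (prime∣^⇒∣ p (ν p h) q-prime q∣p^ν))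
  ... | inj₂ q∣H   = there (hPart-composedOf Q-primes q q-prime q∣H)

  hPart∣h : ∀ {Q} → DistinctPrimes Q → hPart Q ∣ h
  hPart∣h []                        = 1∣ h
  hPart∣h {p ∷ Q} (cons p-prime p∉Q Q-primes) = coprime⇒*∣ p^ν⊥H (p^ν∣h p) (hPart∣h Q-primes)
    where
    p^ν⊥H : Coprime (p ^ ν p h) (hPart Q)
    p^ν⊥H = noCommonPrime⇒coprime (m^n>0 p {{prime⇒nonZero p-prime}} (ν p h)) λ q q-prime q∣p^ν q∣H →
      p∉Q (subst (_∈ Q) (prime∣prime⇒≡ p-prime q-prime (prime∣^⇒∣ p (ν p h) q-prime q∣p^ν)) (hPart-composedOf Q-primes q q-prime q∣H))

  q^ν∣hPart : ∀ {Q q} → q ∈ Q → q ^ ν q h ∣ hPart Q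
  q^ν∣hPart {p ∷ Q} (here refl) = m∣m*n (hPart Q)
  q^ν∣hPart {p ∷ Q} (there q∈Q) = ∣n⇒∣m*n (p ^ ν p h) (q^ν∣hPart q∈Q)

  q*hPart∤h : ∀ {Q q} → DistinctPrimes Q → q ∈ Q → q * hPart Q ∤ h
  q*hPart∤h {Q} {q} Q-primes q∈Q q*H∣h = p^[1+ν]∤h (prime⇒≥2 (∈-distinctPrimes⇒prime Q-primes q∈Q)) (∣-trans (*-monoʳ-∣ q (q^ν∣hPart q∈Q)) q*H∣h)

  composedOf-∣-saturated : ∀ {Q X Y} → ComposedOf Q X → X ∣ h → Y ∣ h → (∀ {p} → p ∈ Q → p * Y ∤ h) → X ∣ Y
  composedOf-∣-saturated {Q} {X} {Y} X∈Q X∣h Y∣h saturated with Y∣h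
  ... | Data.Nat.Divisibility.divides m h≡m*Y = coprime-divisor X⊥m (subst (X ∣_) h≡m*Y X∣h)
    where
    X⊥m : Coprime X m
    X⊥m = noCommonPrime⇒coprime (∣≥1⇒≥1 1≤h X∣h) λ q q-prime q∣X q∣m →
      saturated (X∈Q q q-prime q∣X) (subst (q * Y ∣_) (sym h≡m*Y) (*-monoˡ-∣ Y q∣m))

-- Closed form of the inner sum

module Inner (d h : ℕ) (1≤d : 1 ≤ d) (1≤h : 1 ≤ h) where
  open GcdSum h 1≤h
  open HPart h 1≤h

  Q : List ℕ
  Q = primeDivisors d
  Q-primes : DistinctPrimes (primeDivisors d)
  Q-primes = primeDivisors-distinct d
  H : ℕ
  H = hPart Q

  composedOf-d* : ∀ {v} → ComposedOf Q v → ComposedOf Q (d * v)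
  composedOf-d* v∈Q q q-prime q∣dv with euclidsLemma d _ q-prime q∣dv
  ... | inj₁ q∣d = ∈-primeDivisors⁺ 1≤d q-prime q∣d
  ... | inj₂ q∣v = v∈Q q q-prime q∣v

  inner≡ : ∀ v → inner d h v ≡ (1/ι (φ (d * v)) ℚ.* 1/ι v) ℚ.* ∑μ Q (gcdTerm v)
  inner≡ v = begin
    inner d h v                                                       ≡⟨ cong ℚsum (List.map-cong summand (divisorsOf d)) ⟩
    ℚsum (map (λ a → ιℤ (μ a) ℚ.* (c ℚ.* gcdTerm v a)) (divisorsOf d)) ≡⟨ sum-divisorsOf-μ d 1≤d (λ a → c ℚ.* gcdTerm v a) ⟩
    ∑μ Q (λ a → c ℚ.* gcdTerm v a)                                    ≡⟨ ∑μ-*ˡ Q c (gcdTerm v) ⟩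
    c ℚ.* ∑μ Q (gcdTerm v)                                            ∎
    where
    open ≡-Reasoning
    c : ℚ
    c = 1/ι (φ (d * v)) ℚ.* 1/ι v
    rearrange : ∀ m g f r w → m ℚ.* g ℚ.* (f ℚ.* r ℚ.* w) ≡ m ℚ.* ((f ℚ.* w) ℚ.* (g ℚ.* r))
    rearrange = RingSolver.solve-∀ ℚ-ring
    summand : ∀ a → (μ a ℤ.* + gcd (a * v) h) ÷ℕ (φ (d * v) * a * v) ≡ ιℤ (μ a) ℚ.* (c ℚ.* gcdTerm v a)
    summand a = begin
      (μ a ℤ.* + gcd (a * v) h) ÷ℕ (φ (d * v) * a * v)           ≡⟨ ÷ℕ≡ _ (φ (d * v) * a * v) ⟩
      ιℤ (μ a ℤ.* + gcd (a * v) h) ℚ.* 1/ι (φ (d * v) * a * v)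
        ≡⟨ cong₂ ℚ._*_ (ιℤ-* (μ a) _) (trans (1/ι-* (φ (d * v) * a) v) (cong (ℚ._* 1/ι v) (1/ι-* (φ (d * v)) a))) ⟩
      ιℤ (μ a) ℚ.* ι (gcd (a * v) h) ℚ.* (1/ι (φ (d * v)) ℚ.* 1/ι a ℚ.* 1/ι v)
        ≡⟨ rearrange (ιℤ (μ a)) (ι (gcd (a * v) h)) (1/ι (φ (d * v))) (1/ι a) (1/ι v) ⟩
      ιℤ (μ a) ℚ.* (c ℚ.* gcdTerm v a)                             ∎

  gcd∣H : ∀ {v} → ComposedOf Q v → gcd v h ∣ H
  gcd∣H {v} v∈Q = composedOf-∣-saturated (λ q q-prime q∣g → v∈Q q q-prime (∣-trans q∣g (gcd[m,n]∣m v h))) (gcd[m,n]∣n v h)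
                             (hPart∣h Q-primes) (q*hPart∤h Q-primes)

  gcd≡H : ∀ {v} → ComposedOf Q v → ¬ Any (Deficient v) Q → gcd v h ≡ H
  gcd≡H {v} v∈Q none = ∣-antisym (gcd∣H v∈Q) (composedOf-∣-saturated (hPart-composedOf Q-primes) (hPart∣h Q-primes) (gcd[m,n]∣n v h)
                                   (λ q∈Q q-def → none (Any.map (λ { refl → q-def }) q∈Q)))

  H∣v⇒sufficient : ∀ {v} → ComposedOf Q v → H ∣ v → ¬ Any (Deficient v) Q
  H∣v⇒sufficient {v} v∈Q H∣v Q-def with find Q-def
  ... | q , q∈Q , q*g∣h = q*hPart∤h Q-primes q∈Q (subst (λ g → q * g ∣ h) g≡H q*g∣h)
    where
    g≡H : gcd v h ≡ H
    g≡H = ∣-antisym (gcd∣H v∈Q) (gcd-greatest H∣v (hPart∣h Q-primes))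

  φ[d*v]*rad≡ : ∀ v → 1 ≤ v → ComposedOf Q v → φ (d * v) * rad d ≡ d * v * product (map (_∸ 1) Q)
  φ[d*v]*rad≡ v 1≤v v∈Q = trans (cong (_* rad d) (φ≡sieveCount (d * v) (*-mono-≤ 1≤d 1≤v) Q-primes (composedOf-d* v∈Q) Q∣dv))
                                (sieveCount-product Q-primes (d * v) (∣-trans (rad∣ d) (m∣m*n v)))
    where
    Q∣dv : ∀ {q} → q ∈ Q → q ∣ d * v
    Q∣dv q∈Q = ∣-trans (proj₂ (∈-primeDivisors⁻ {n = d} q∈Q)) (m∣m*n v)

  inner-H∣v : ∀ v → 1 ≤ v → ComposedOf Q v → H ∣ v → inner d h v ≡ ι H ℚ.* 1/ι (d * v * v)
  inner-H∣v v 1≤v v∈Q H∣v = begin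
    inner d h v                                              ≡⟨ inner≡ v ⟩
    1/ι f ℚ.* 1/ι v ℚ.* ∑μ Q (gcdTerm v)
      ≡⟨ cong (1/ι f ℚ.* 1/ι v ℚ.*_) (trans (∑μ-gcdTerm-sufficient Q-primes v sufficient)
                                            (cong₂ ℚ._*_ (cong ι (gcd≡H v∈Q sufficient)) (Φ≡ Q-primes))) ⟩
    1/ι f ℚ.* 1/ι v ℚ.* (ι H ℚ.* (ι A ℚ.* 1/ι (rad d)))     ≡⟨ rearrange (1/ι f) (1/ι v) (ι H) (ι A) (1/ι (rad d)) ⟩
    ι H ℚ.* 1/ι v ℚ.* (ι A ℚ.* (1/ι f ℚ.* 1/ι (rad d)))     ≡⟨ cong (λ x → ι H ℚ.* 1/ι v ℚ.* (ι A ℚ.* x)) (sym (1/ι-* f (rad d))) ⟩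
    ι H ℚ.* 1/ι v ℚ.* (ι A ℚ.* 1/ι (f * rad d))             ≡⟨ cong (λ n → ι H ℚ.* 1/ι v ℚ.* (ι A ℚ.* 1/ι n)) (φ[d*v]*rad≡ v 1≤v v∈Q) ⟩
    ι H ℚ.* 1/ι v ℚ.* (ι A ℚ.* 1/ι (d * v * A))             ≡⟨ cong (ι H ℚ.* 1/ι v ℚ.*_) (ι[n]*1/ι[m*n]≡1/ι[m] (d * v) A (product-pred≥1 Q-primes)) ⟩
    ι H ℚ.* 1/ι v ℚ.* 1/ι (d * v)                           ≡⟨ ℚP.*-assoc (ι H) (1/ι v) (1/ι (d * v)) ⟩
    ι H ℚ.* (1/ι v ℚ.* 1/ι (d * v))                         ≡⟨ cong (ι H ℚ.*_) (trans (ℚP.*-comm (1/ι v) _) (sym (1/ι-* (d * v) v))) ⟩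
    ι H ℚ.* 1/ι (d * v * v)                                 ∎
    where
    open ≡-Reasoning
    f A : ℕ
    f = φ (d * v)
    A = product (map (_∸ 1) Q)
    sufficient : ¬ Any (Deficient v) Q
    sufficient = H∣v⇒sufficient v∈Q H∣v
    rearrange : ∀ f w x a r → f ℚ.* w ℚ.* (x ℚ.* (a ℚ.* r)) ≡ x ℚ.* w ℚ.* (a ℚ.* (f ℚ.* r))
    rearrange = RingSolver.solve-∀ ℚ-ring

  inner-H∤v : ∀ v → ComposedOf Q v → H ∤ v → inner d h v ≡ 0ℚ
  inner-H∤v v v∈Q H∤v with Any.any? (λ q → q * gcd v h ∣? h) Q
  ... | yes Q-def = trans (inner≡ v) (trans (cong (c ℚ.*_) (∑μ-gcdTerm-deficient Q-primes v Q-def)) (ℚP.*-zeroʳ c))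
    where
    c : ℚ
    c = 1/ι (φ (d * v)) ℚ.* 1/ι v
  ... | no  none  = ⊥-elim (H∤v (subst (_∣ v) (gcd≡H v∈Q none) (gcd[m,n]∣m v h)))

-- The series of 1/w² over w ∣ d^∞

-- Defs.divInf d is definitionally primeFactorsSatisfyᵇ (_∣? d).
primeFactorsSatisfyᵇ : ∀ {X : ℕ → Set} → (∀ p → Dec (X p)) → ℕ → Bool
primeFactorsSatisfyᵇ X? zero        = false
primeFactorsSatisfyᵇ X? w@(suc _) = foldr (λ p b → does (primeDivisor? w p →-dec X? p) ∧ b) true (range1 w)

primeFactorsSatisfyᵇ⁻ : ∀ {X : ℕ → Set} (X? : ∀ p → Dec (X p)) w → T (primeFactorsSatisfyᵇ X? w) →
                        1 ≤ w × (∀ q → Prime q → q ∣ w → X q)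
primeFactorsSatisfyᵇ⁻ X? w@(suc _) t = s≤s z≤n , λ q q-prime q∣w →
  T-does⁻¹ (primeDivisor? w q →-dec X? q) (T-all⁻ (λ p → does (primeDivisor? w p →-dec X? p)) (range1 w) t
    (∈-range1⁺ (prime⇒≥1 q-prime) (∣⇒≤ q∣w))) (q-prime , q∣w)

primeFactorsSatisfyᵇ⁺ : ∀ {X : ℕ → Set} (X? : ∀ p → Dec (X p)) w → 1 ≤ w → (∀ q → Prime q → q ∣ w → X q) →
                        T (primeFactorsSatisfyᵇ X? w)
primeFactorsSatisfyᵇ⁺ X? w@(suc _) _ all-X = T-all⁺ (λ p → does (primeDivisor? w p →-dec X? p)) (range1 w)
  (λ {p} _ → T-does (primeDivisor? w p →-dec X? p) (λ (p-prime , p∣w) → all-X p p-prime p∣w))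

composedOfᵇ : List ℕ → ℕ → Bool
composedOfᵇ Q = primeFactorsSatisfyᵇ (_∈? Q)

divInf≡composedOfᵇ : ∀ d → 1 ≤ d → ∀ v → divInf d v ≡ composedOfᵇ (primeDivisors d) v
divInf≡composedOfᵇ d 1≤d zero    = refl
divInf≡composedOfᵇ d 1≤d v@(suc _) = T-ext
  (λ t → primeFactorsSatisfyᵇ⁺ (_∈? Q) v (s≤s z≤n) λ q q-prime q∣v →
     ∈-primeDivisors⁺ 1≤d q-prime (proj₂ (primeFactorsSatisfyᵇ⁻ (_∣? d) v t) q q-prime q∣v))
  (λ t → primeFactorsSatisfyᵇ⁺ (_∣? d) v (s≤s z≤n) λ q q-prime q∣v →
     proj₂ (∈-primeDivisors⁻ (proj₂ (primeFactorsSatisfyᵇ⁻ (_∈? Q) v t) q q-prime q∣v)))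
  where
  Q : List ℕ
  Q = primeDivisors d

composedOfᵇ⁻ : ∀ Q w → T (composedOfᵇ Q w) → 1 ≤ w × ComposedOf Q w
composedOfᵇ⁻ Q = primeFactorsSatisfyᵇ⁻ (_∈? Q)

composedOfᵇ⁺ : ∀ Q w → 1 ≤ w → ComposedOf Q w → T (composedOfᵇ Q w)
composedOfᵇ⁺ Q = primeFactorsSatisfyᵇ⁺ (_∈? Q)

composedOfᵇ-* : ∀ {Q m w} → 1 ≤ m → 1 ≤ w → ComposedOf Q m → composedOfᵇ Q (m * w) ≡ composedOfᵇ Q w
composedOfᵇ-* {Q} {m} {w} 1≤m 1≤w m∈Q = T-ext
  (λ t → composedOfᵇ⁺ Q w 1≤w λ q q-prime q∣w → proj₂ (composedOfᵇ⁻ Q (m * w) t) q q-prime (∣n⇒∣m*n m q∣w))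
  (λ t → composedOfᵇ⁺ Q (m * w) (*-mono-≤ 1≤m 1≤w) λ q q-prime q∣mw →
     [ m∈Q q q-prime , proj₂ (composedOfᵇ⁻ Q w t) q q-prime ]′ (euclidsLemma m w q-prime q∣mw))

composedOfᵇ-∷-∤ : ∀ {p Q w} → 1 ≤ w → p ∤ w → composedOfᵇ (p ∷ Q) w ≡ composedOfᵇ Q w
composedOfᵇ-∷-∤ {p} {Q} {w} 1≤w p∤w = T-ext
  (λ t → composedOfᵇ⁺ Q w 1≤w λ q q-prime q∣w → drop-p (proj₂ (composedOfᵇ⁻ (p ∷ Q) w t) q q-prime q∣w) q∣w)
  (λ t → composedOfᵇ⁺ (p ∷ Q) w 1≤w λ q q-prime q∣w → there (proj₂ (composedOfᵇ⁻ Q w t) q q-prime q∣w))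
  where
  drop-p : ∀ {q} → q ∈ p ∷ Q → q ∣ w → q ∈ Q
  drop-p (here refl) p∣w = ⊥-elim (p∤w p∣w)
  drop-p (there q∈Q) _   = q∈Q

composedOf[]⇒≡1 : ∀ {w} → 1 ≤ w → ComposedOf [] w → w ≡ 1
composedOf[]⇒≡1 {w} 1≤w w∈[] with w ≟ 1
... | yes w≡1 = w≡1
... | no  w≢1 with primeFactor w (≤∧≢⇒< 1≤w (w≢1 ∘ sym))
...   | q , q-prime , q∣w with () ← w∈[] q q-prime q∣w

recipSquares : List ℕ → ℕ → ℚ
recipSquares Q M = ∑ M (λ w → when (composedOfᵇ Q w) (1/ι (w * w)))

recipSquares-[] : ∀ M → recipSquares [] (suc M) ≡ 1ℚ
recipSquares-[] M = ∑-single (suc M) 1 (s≤s z≤n) (s≤s z≤n) only-1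
  where
  only-1 : ∀ w → w ≢ 1 → when (composedOfᵇ [] w) (1/ι (w * w)) ≡ 0ℚ
  only-1 w w≢1 with composedOfᵇ [] w in t
  ... | false = refl
  ... | true  = ⊥-elim (w≢1 (uncurry composedOf[]⇒≡1 (composedOfᵇ⁻ [] w (subst T (sym t) tt))))

recipSquares-∷ : ∀ {p Q} .{{_ : NonZero p}} → DistinctPrimes (p ∷ Q) → ∀ M →
                 recipSquares (p ∷ Q) M ≡ recipSquares Q M ℚ.+ 1/ι (p * p) ℚ.* recipSquares (p ∷ Q) (M / p)
recipSquares-∷ {p} {Q} (cons p-prime p∉Q _) M = begin
  recipSquares (p ∷ Q) M
    ≡⟨ ∑-split M (divides p) term ⟩
  ∑ M (λ w → when (divides p w) (term w)) ℚ.+ ∑ M (λ w → when (not (divides p w)) (term w))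
    ≡⟨ cong₂ ℚ._+_ (trans (∑-multiples p M term) (∑-cong (M / p) (λ j 1≤j _ → multiple j 1≤j))) (∑-cong M (λ w 1≤w _ → non-multiple w 1≤w)) ⟩
  ∑ (M / p) (λ j → 1/ι (p * p) ℚ.* term j) ℚ.+ recipSquares Q M
    ≡⟨ cong (ℚ._+ recipSquares Q M) (∑-*ˡ (1/ι (p * p)) (M / p) term) ⟩
  1/ι (p * p) ℚ.* recipSquares (p ∷ Q) (M / p) ℚ.+ recipSquares Q M
    ≡⟨ ℚP.+-comm _ (recipSquares Q M) ⟩
  recipSquares Q M ℚ.+ 1/ι (p * p) ℚ.* recipSquares (p ∷ Q) (M / p) ∎
  where
  open ≡-Reasoning
  term : ℕ → ℚ
  term w = when (composedOfᵇ (p ∷ Q) w) (1/ι (w * w))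
  non-multiple : ∀ w → 1 ≤ w → when (not (divides p w)) (term w) ≡ when (composedOfᵇ Q w) (1/ι (w * w))
  non-multiple w 1≤w with p ∣? w
  ... | no  p∤w = cong (λ b → when b (1/ι (w * w))) (composedOfᵇ-∷-∤ 1≤w p∤w)
  ... | yes p∣w with composedOfᵇ Q w in t
  ...   | true  = ⊥-elim (p∉Q (proj₂ (composedOfᵇ⁻ Q w (subst T (sym t) tt)) p p-prime p∣w))
  ...   | false = refl
  p∈p∷Q : ComposedOf (p ∷ Q) p
  p∈p∷Q q q-prime q∣p = here (prime∣prime⇒≡ p-prime q-prime q∣p)
  multiple : ∀ j → 1 ≤ j → term (p * j) ≡ 1/ι (p * p) ℚ.* term j
  multiple j 1≤j = trans (cong₂ when (composedOfᵇ-* (prime⇒≥1 p-prime) 1≤j p∈p∷Q) (trans (cong 1/ι (square-* p j)) (1/ι-* (p * p) (j * j))))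
                         (when-*ˡ (1/ι (p * p)) (composedOfᵇ (p ∷ Q) j) (1/ι (j * j)))
    where
    square-* : ∀ p j → p * j * (p * j) ≡ p * p * (j * j)
    square-* = solve-∀

eulerFactor : ℕ → ℚ
eulerFactor p = (+ (p * p)) ÷ℕ (p * p ∸ 1)

eulerProduct : List ℕ → ℚ
eulerProduct Q = ℚprod (map eulerFactor Q)

1≤p*p∸1 : ∀ {p} → 2 ≤ p → 1 ≤ p * p ∸ 1
1≤p*p∸1 2≤p = ≤-trans (s≤s z≤n) (∸-monoˡ-≤ 1 (*-mono-≤ 2≤p 2≤p))

eulerFactor≡1+ : ∀ {p} → 2 ≤ p → eulerFactor p ≡ 1ℚ ℚ.+ 1/ι (p * p ∸ 1)
eulerFactor≡1+ {p} 2≤p = begin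
  eulerFactor p                         ≡⟨ ÷ℕ≡ (+ P) (P ∸ 1) ⟩
  ι P ℚ.* 1/ι (P ∸ 1)                   ≡⟨ cong (λ n → ι n ℚ.* 1/ι (P ∸ 1)) (sym (m∸n+n≡m 1≤P)) ⟩
  ι (P ∸ 1 + 1) ℚ.* 1/ι (P ∸ 1)         ≡⟨ cong (ℚ._* 1/ι (P ∸ 1)) (ι-+ (P ∸ 1) 1) ⟩
  (ι (P ∸ 1) ℚ.+ 1ℚ) ℚ.* 1/ι (P ∸ 1)    ≡⟨ distrib (ι (P ∸ 1)) (1/ι (P ∸ 1)) ⟩
  ι (P ∸ 1) ℚ.* 1/ι (P ∸ 1) ℚ.+ 1/ι (P ∸ 1) ≡⟨ cong (ℚ._+ 1/ι (P ∸ 1)) (ι*1/ι≡1 {P ∸ 1} (1≤p*p∸1 2≤p)) ⟩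
  1ℚ ℚ.+ 1/ι (P ∸ 1)                    ∎
  where
  open ≡-Reasoning
  P : ℕ
  P = p * p
  1≤P : 1 ≤ P
  1≤P = ≤-trans (s≤s z≤n) (*-mono-≤ 2≤p 2≤p)
  distrib : ∀ x r → (x ℚ.+ 1ℚ) ℚ.* r ≡ x ℚ.* r ℚ.+ r
  distrib = RingSolver.solve-∀ ℚ-ring

eulerFactor-fixpoint : ∀ {p} → 2 ≤ p → eulerFactor p ≡ 1ℚ ℚ.+ 1/ι (p * p) ℚ.* eulerFactor p
eulerFactor-fixpoint {p} 2≤p = begin
  eulerFactor p                                     ≡⟨ eulerFactor≡1+ 2≤p ⟩
  1ℚ ℚ.+ 1/ι (P ∸ 1)                                ≡⟨ cong (1ℚ ℚ.+_) (sym (trans (cong (ℚ._* 1/ι (P ∸ 1)) (trans (ℚP.*-comm (1/ι P) (ι P)) (ι*1/ι≡1 {P} 1≤P))) (ℚP.*-identityˡ (1/ι (P ∸ 1))))) ⟩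
  1ℚ ℚ.+ 1/ι P ℚ.* ι P ℚ.* 1/ι (P ∸ 1)              ≡⟨ cong (1ℚ ℚ.+_) (trans (ℚP.*-assoc (1/ι P) (ι P) _) (cong (1/ι P ℚ.*_) (sym (÷ℕ≡ (+ P) (P ∸ 1))))) ⟩
  1ℚ ℚ.+ 1/ι P ℚ.* eulerFactor p                    ∎
  where
  open ≡-Reasoning
  P : ℕ
  P = p * p
  1≤P : 1 ≤ P
  1≤P = ≤-trans (s≤s z≤n) (*-mono-≤ 2≤p 2≤p)

0≤eulerProduct : ∀ {Q} → DistinctPrimes Q → 0ℚ ℚ.≤ eulerProduct Q
0≤eulerProduct []                        = 0≤ι 1
0≤eulerProduct {p ∷ Q} (cons p-prime _ Q-primes) = 0≤* 0≤eulerFactor (0≤eulerProduct Q-primes)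
  where
  0≤eulerFactor : 0ℚ ℚ.≤ eulerFactor p
  0≤eulerFactor = subst (0ℚ ℚ.≤_) (sym (eulerFactor≡1+ (prime⇒≥2 p-prime))) (ℚP.+-mono-≤ (0≤ι 1) (0≤1/ι (p * p ∸ 1)))

eulerProduct≤2^ : ∀ {Q} → DistinctPrimes Q → eulerProduct Q ℚ.≤ ι (2 ^ length Q)
eulerProduct≤2^ []                                = ℚP.≤-refl
eulerProduct≤2^ {p ∷ Q} (cons p-prime _ Q-primes) = begin
  eulerFactor p ℚ.* eulerProduct Q   ≤⟨ *-monoʳ-≤-0≤ (0≤eulerProduct Q-primes) eulerFactor≤2 ⟩
  ι 2 ℚ.* eulerProduct Q             ≤⟨ *-monoˡ-≤-0≤ (0≤ι 2) (eulerProduct≤2^ Q-primes) ⟩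
  ι 2 ℚ.* ι (2 ^ length Q)           ≡⟨ sym (ι-* 2 (2 ^ length Q)) ⟩
  ι (2 ^ suc (length Q))             ∎
  where
  open ℚP.≤-Reasoning
  eulerFactor≤2 : eulerFactor p ℚ.≤ ι 2
  eulerFactor≤2 = subst (ℚ._≤ ι 2) (sym (eulerFactor≡1+ (prime⇒≥2 p-prime)))
    (ℚP.+-monoʳ-≤ 1ℚ (1/ι-anti-≤ {1} (s≤s z≤n) (1≤p*p∸1 (prime⇒≥2 p-prime))))

error : List ℕ → ℕ → ℚ
error Q M = recipSquares Q M ℚ.- eulerProduct Q

error-∷ : ∀ {p Q} .{{_ : NonZero p}} → DistinctPrimes (p ∷ Q) → ∀ M →
          error (p ∷ Q) M ≡ error Q M ℚ.+ 1/ι (p * p) ℚ.* error (p ∷ Q) (M / p)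
error-∷ {p} {Q} p∷Q-primes@(cons p-prime _ _) M = begin
  recipSquares (p ∷ Q) M ℚ.- eulerFactor p ℚ.* eulerProduct Q
    ≡⟨ cong₂ (λ s e → s ℚ.- e ℚ.* eulerProduct Q) (recipSquares-∷ p∷Q-primes M) (eulerFactor-fixpoint (prime⇒≥2 p-prime)) ⟩
  recipSquares Q M ℚ.+ r ℚ.* s′ ℚ.- (1ℚ ℚ.+ r ℚ.* eulerFactor p) ℚ.* eulerProduct Q
    ≡⟨ regroup (recipSquares Q M) r s′ (eulerFactor p) (eulerProduct Q) ⟩
  error Q M ℚ.+ r ℚ.* (s′ ℚ.- eulerFactor p ℚ.* eulerProduct Q) ∎
  where
  open ≡-Reasoning
  r s′ : ℚ
  r  = 1/ι (p * p)
  s′ = recipSquares (p ∷ Q) (M / p)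
  regroup : ∀ s r s′ t l → s ℚ.+ r ℚ.* s′ ℚ.- (1ℚ ℚ.+ r ℚ.* t) ℚ.* l ≡ (s ℚ.- l) ℚ.+ r ℚ.* (s′ ℚ.- t ℚ.* l)
  regroup = RingSolver.solve-∀ ℚ-ring

-- By error-∷ and M + 1 ≤ p (M / p + 1), strong induction on M bounds the error for p ∷ Q by
-- 2^|Q| + 2^(|Q|+1) / p ≤ 2^(|Q|+1): this is where the constant 2^|Q| comes from.
error-bound : ∀ {Q} → DistinctPrimes Q → ∀ M → ℚ.∣ error Q M ∣ ℚ.* ι (suc M) ℚ.≤ ι (2 ^ length Q)
error-bound [] zero    = ℚP.≤-refl
error-bound [] (suc M) = ℚP.≤-trans (ℚP.≤-reflexive (trans (cong (λ s → ℚ.∣ s ℚ.- 1ℚ ∣ ℚ.* ι (suc (suc M))) (recipSquares-[] M))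
                                                          (ℚP.*-zeroˡ (ι (suc (suc M)))))) (0≤ι 1)
error-bound {p ∷ Q} p∷Q-primes@(cons p-prime _ Q-primes) = <-rec _ step
  where
  instance
    p-nonZero : NonZero p
    p-nonZero = prime⇒nonZero p-prime
  C′ C : ℚ
  C′ = ι (2 ^ length Q)
  C  = ι (2 ^ suc (length Q))
  C≡C′+C′ : C ≡ C′ ℚ.+ C′
  C≡C′+C′ = trans (cong ι (cong (λ n → 2 ^ length Q + n) (+-identityʳ (2 ^ length Q)))) (ι-+ (2 ^ length Q) (2 ^ length Q))
  half : ∀ x → 1/ι 2 ℚ.* (x ℚ.+ x) ≡ x
  half = RingSolver.solve-∀ ℚ-ring
  step : ∀ M → (∀ {M′} → M′ < M → ℚ.∣ error (p ∷ Q) M′ ∣ ℚ.* ι (suc M′) ℚ.≤ C) → ℚ.∣ error (p ∷ Q) M ∣ ℚ.* ι (suc M) ℚ.≤ C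
  step zero _ = begin
    ℚ.∣ 0ℚ ℚ.- eulerProduct (p ∷ Q) ∣ ℚ.* 1ℚ  ≡⟨ ℚP.*-identityʳ _ ⟩
    ℚ.∣ 0ℚ ℚ.- eulerProduct (p ∷ Q) ∣         ≡⟨ cong ℚ.∣_∣ (ℚP.+-identityˡ _) ⟩
    ℚ.∣ ℚ.- eulerProduct (p ∷ Q) ∣            ≡⟨ ℚP.∣-p∣≡∣p∣ (eulerProduct (p ∷ Q)) ⟩
    ℚ.∣ eulerProduct (p ∷ Q) ∣                ≡⟨ ℚP.0≤p⇒∣p∣≡p (0≤eulerProduct p∷Q-primes) ⟩
    eulerProduct (p ∷ Q)                      ≤⟨ eulerProduct≤2^ p∷Q-primes ⟩
    C                                         ∎
    where open ℚP.≤-Reasoning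
  step M@(suc _) rec = begin
    ℚ.∣ error (p ∷ Q) M ∣ ℚ.* ι (suc M)         ≤⟨ *-monoʳ-≤-0≤ (0≤ι (suc M)) triangle ⟩
    (a ℚ.+ r ℚ.* b) ℚ.* ι (suc M)               ≡⟨ ℚP.*-distribʳ-+ (ι (suc M)) a (r ℚ.* b) ⟩
    a ℚ.* ι (suc M) ℚ.+ r ℚ.* b ℚ.* ι (suc M)   ≤⟨ ℚP.+-mono-≤ (error-bound Q-primes M) (*-monoˡ-≤-0≤ (0≤* (0≤1/ι (p * p)) (ℚP.0≤∣p∣ _)) 1+M≤p[1+M/p]) ⟩
    C′ ℚ.+ r ℚ.* b ℚ.* (ι p ℚ.* ι (suc X))       ≡⟨ cong (C′ ℚ.+_) (rearrange r b (ι p) (ι (suc X))) ⟩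
    C′ ℚ.+ r ℚ.* ι p ℚ.* (b ℚ.* ι (suc X))       ≤⟨ ℚP.+-monoʳ-≤ C′ (*-monoˡ-≤-0≤ (0≤* (0≤1/ι (p * p)) (0≤ι p)) (rec (m/n<m M p (prime⇒≥2 p-prime)))) ⟩
    C′ ℚ.+ r ℚ.* ι p ℚ.* C                       ≡⟨ cong (λ x → C′ ℚ.+ x ℚ.* C) 1/p²*p≡1/p ⟩
    C′ ℚ.+ 1/ι p ℚ.* C                           ≤⟨ ℚP.+-monoʳ-≤ C′ (*-monoʳ-≤-0≤ (0≤ι (2 ^ suc (length Q))) (1/ι-anti-≤ {2} (s≤s z≤n) (prime⇒≥2 p-prime))) ⟩
    C′ ℚ.+ 1/ι 2 ℚ.* C                           ≡⟨ cong (λ x → C′ ℚ.+ 1/ι 2 ℚ.* x) C≡C′+C′ ⟩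
    C′ ℚ.+ 1/ι 2 ℚ.* (C′ ℚ.+ C′)                 ≡⟨ cong (C′ ℚ.+_) (half C′) ⟩
    C′ ℚ.+ C′                                    ≡⟨ sym C≡C′+C′ ⟩
    C                                            ∎
    where
    open ℚP.≤-Reasoning
    X : ℕ
    X = M / p
    r a b : ℚ
    r = 1/ι (p * p)
    a = ℚ.∣ error Q M ∣
    b = ℚ.∣ error (p ∷ Q) X ∣
    triangle : ℚ.∣ error (p ∷ Q) M ∣ ℚ.≤ a ℚ.+ r ℚ.* b
    triangle = begin
      ℚ.∣ error (p ∷ Q) M ∣                    ≡⟨ cong ℚ.∣_∣ (error-∷ p∷Q-primes M) ⟩
      ℚ.∣ error Q M ℚ.+ r ℚ.* error (p ∷ Q) X ∣ ≤⟨ ℚP.∣p+q∣≤∣p∣+∣q∣ (error Q M) (r ℚ.* error (p ∷ Q) X) ⟩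
      a ℚ.+ ℚ.∣ r ℚ.* error (p ∷ Q) X ∣         ≡⟨ cong (a ℚ.+_) (trans (ℚP.∣p*q∣≡∣p∣*∣q∣ r _) (cong (ℚ._* b) (ℚP.0≤p⇒∣p∣≡p (0≤1/ι (p * p))))) ⟩
      a ℚ.+ r ℚ.* b                             ∎
    1+M≤p[1+M/p] : ι (suc M) ℚ.≤ ι p ℚ.* ι (suc X)
    1+M≤p[1+M/p] = ℚP.≤-trans (ι-mono-≤ (m<n*[1+m/n] M p)) (ℚP.≤-reflexive (ι-* p (suc X)))
    rearrange : ∀ r b i j → r ℚ.* b ℚ.* (i ℚ.* j) ≡ r ℚ.* i ℚ.* (b ℚ.* j)
    rearrange = RingSolver.solve-∀ ℚ-ring
    1/p²*p≡1/p : r ℚ.* ι p ≡ 1/ι p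
    1/p²*p≡1/p = trans (ℚP.*-comm r (ι p)) (ι[n]*1/ι[m*n]≡1/ι[m] p p (prime⇒≥1 p-prime))

-- Partial sums

module PartialSums (d h : ℕ) (1≤d : 1 ≤ d) (1≤h : 1 ≤ h) where
  open Inner d h 1≤d 1≤h
  open HPart h 1≤h using (hPart≥1; hPart-composedOf)

  H≥1 : 1 ≤ H
  H≥1 = hPart≥1 Q-primes

  instance
    H-nonZero : NonZero H
    H-nonZero = ℕ.>-nonZero H≥1

  partialSum≡ : ∀ N → partialSum d h N ≡ 1/ι (d * H) ℚ.* recipSquares Q (N / H)
  partialSum≡ N = begin
    partialSum d h N                                              ≡⟨ sum-filterᵇ (divInf d) (inner d h) (range1 N) ⟩
    ℚsum (map (λ v → when (divInf d v) (inner d h v)) (range1 N)) ≡⟨ sum-range1 _ N ⟩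
    ∑ N (λ v → when (divInf d v) (inner d h v))                  ≡⟨ ∑-cong N (λ v 1≤v _ → restrict v 1≤v) ⟩
    ∑ N (λ v → when (divides H v) (term v))                       ≡⟨ ∑-multiples H N term ⟩
    ∑ (N / H) (λ w → term (H * w))                                ≡⟨ ∑-cong (N / H) (λ w 1≤w _ → rescale w 1≤w) ⟩
    ∑ (N / H) (λ w → 1/ι (d * H) ℚ.* when (composedOfᵇ Q w) (1/ι (w * w))) ≡⟨ ∑-*ˡ (1/ι (d * H)) (N / H) _ ⟩
    1/ι (d * H) ℚ.* recipSquares Q (N / H)                        ∎
    where
    open ≡-Reasoning
    term : ℕ → ℚ
    term v = when (composedOfᵇ Q v) (ι H ℚ.* 1/ι (d * v * v))
    restrict : ∀ v → 1 ≤ v → when (divInf d v) (inner d h v) ≡ when (divides H v) (term v)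
    restrict v 1≤v = trans (cong (λ b → when b (inner d h v)) (divInf≡composedOfᵇ d 1≤d v)) (by-support (composedOfᵇ Q v) (composedOfᵇ⁻ Q v))
      where
      by-support : ∀ b → (T b → 1 ≤ v × ComposedOf Q v) →
                   when b (inner d h v) ≡ when (divides H v) (when b (ι H ℚ.* 1/ι (d * v * v)))
      by-support false _ = sym (when-ε (divides H v))
      by-support true  v∈Q with H ∣? v
      ... | yes H∣v = inner-H∣v v 1≤v (proj₂ (v∈Q tt)) H∣v
      ... | no  H∤v = inner-H∤v v (proj₂ (v∈Q tt)) H∤v
    rescale : ∀ w → 1 ≤ w → term (H * w) ≡ 1/ι (d * H) ℚ.* when (composedOfᵇ Q w) (1/ι (w * w))
    rescale w 1≤w = trans (cong₂ when (composedOfᵇ-* H≥1 1≤w (hPart-composedOf Q-primes)) value) (when-*ˡ (1/ι (d * H)) (composedOfᵇ Q w) (1/ι (w * w)))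
      where
      reassoc : ∀ d H w → d * (H * w) * (H * w) ≡ d * H * (w * w) * H
      reassoc = solve-∀
      rearrange : ∀ i a b r → i ℚ.* (a ℚ.* b ℚ.* r) ≡ a ℚ.* b ℚ.* (i ℚ.* r)
      rearrange = RingSolver.solve-∀ ℚ-ring
      value : ι H ℚ.* 1/ι (d * (H * w) * (H * w)) ≡ 1/ι (d * H) ℚ.* 1/ι (w * w)
      value = begin
        ι H ℚ.* 1/ι (d * (H * w) * (H * w))                 ≡⟨ cong (λ n → ι H ℚ.* 1/ι n) (reassoc d H w) ⟩
        ι H ℚ.* 1/ι (d * H * (w * w) * H)                   ≡⟨ cong (ι H ℚ.*_) (trans (1/ι-* (d * H * (w * w)) H) (cong (ℚ._* 1/ι H) (1/ι-* (d * H) (w * w)))) ⟩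
        ι H ℚ.* (1/ι (d * H) ℚ.* 1/ι (w * w) ℚ.* 1/ι H)     ≡⟨ rearrange (ι H) (1/ι (d * H)) (1/ι (w * w)) (1/ι H) ⟩
        1/ι (d * H) ℚ.* 1/ι (w * w) ℚ.* (ι H ℚ.* 1/ι H)     ≡⟨ cong (1/ι (d * H) ℚ.* 1/ι (w * w) ℚ.*_) (ι*1/ι≡1 H≥1) ⟩
        1/ι (d * H) ℚ.* 1/ι (w * w) ℚ.* 1ℚ                  ≡⟨ ℚP.*-identityʳ _ ⟩
        1/ι (d * H) ℚ.* 1/ι (w * w)                         ∎

  S≡ : S d h ≡ 1/ι (d * H) ℚ.* eulerProduct Q
  S≡ = cong (ℚ._* eulerProduct Q) (trans (÷ℕ≡ (+ 1) (d * H)) (ℚP.*-identityˡ (1/ι (d * H))))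

  partialSum-S-bound : ∀ N → ℚ.∣ partialSum d h N ℚ.- S d h ∣ ℚ.≤ ι (2 ^ length Q) ℚ.* 1/ι (suc N)
  partialSum-S-bound N = begin
    ℚ.∣ partialSum d h N ℚ.- S d h ∣                           ≡⟨ cong ℚ.∣_∣ (cong₂ ℚ._-_ (partialSum≡ N) S≡) ⟩
    ℚ.∣ c ℚ.* recipSquares Q M ℚ.- c ℚ.* eulerProduct Q ∣       ≡⟨ cong ℚ.∣_∣ (*-distribˡ-- c (recipSquares Q M) (eulerProduct Q)) ⟩
    ℚ.∣ c ℚ.* error Q M ∣                                      ≡⟨ trans (ℚP.∣p*q∣≡∣p∣*∣q∣ c (error Q M)) (cong (ℚ._* ℚ.∣ error Q M ∣) (ℚP.0≤p⇒∣p∣≡p (0≤1/ι (d * H)))) ⟩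
    c ℚ.* ℚ.∣ error Q M ∣                                      ≡⟨ cong (c ℚ.*_) (sym (cancel ℚ.∣ error Q M ∣ (ι (suc M)) (1/ι (suc M)) (ι*1/ι≡1 {suc M} (s≤s z≤n)))) ⟩
    c ℚ.* (ℚ.∣ error Q M ∣ ℚ.* ι (suc M) ℚ.* 1/ι (suc M))      ≤⟨ *-monoˡ-≤-0≤ (0≤1/ι (d * H)) (*-monoʳ-≤-0≤ (0≤1/ι (suc M)) (error-bound Q-primes M)) ⟩
    c ℚ.* (C ℚ.* 1/ι (suc M))                                  ≡⟨ ℚ*.x∙yz≈y∙xz c C (1/ι (suc M)) ⟩
    C ℚ.* (c ℚ.* 1/ι (suc M))                                  ≡⟨ cong (C ℚ.*_) (sym (1/ι-* (d * H) (suc M))) ⟩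
    C ℚ.* 1/ι (d * H * suc M)                                  ≤⟨ *-monoˡ-≤-0≤ (0≤ι (2 ^ length Q)) (1/ι-anti-≤ (s≤s z≤n) 1+N≤dH[1+M]) ⟩
    C ℚ.* 1/ι (suc N)                                          ∎
    where
    open ℚP.≤-Reasoning
    M : ℕ
    M = N / H
    c C : ℚ
    c = 1/ι (d * H)
    C = ι (2 ^ length Q)
    cancel : ∀ a i r → i ℚ.* r ≡ 1ℚ → a ℚ.* i ℚ.* r ≡ a
    cancel a i r i*r≡1 = trans (ℚP.*-assoc a i r) (trans (cong (a ℚ.*_) i*r≡1) (ℚP.*-identityʳ a))
    1+N≤dH[1+M] : suc N ≤ d * H * suc M
    1+N≤dH[1+M] = ≤-trans (m<n*[1+m/n] N H) (subst (H * suc M ≤_) (sym (*-assoc d H (suc M))) (m≤n*m (H * suc M) d {{ℕ.>-nonZero 1≤d}}))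

archimedean : ∀ C ε → 0ℚ ℚ.< ε → ∃ λ N → ∀ n → N ≤ n → ι C ℚ.* 1/ι (suc n) ℚ.< ε
archimedean C (mkℚ (+ zero)  _ _) (ℚ.*<* (ℤ.+<+ ()))
archimedean C (mkℚ -[1+ _ ]  _ _) (ℚ.*<* ())
archimedean C ε@(mkℚ (+ suc k) den-1 _) _ = N , λ n N≤n →
  ℚP.≤-<-trans (*-monoˡ-≤-0≤ (0≤ι C) (1/ι-anti-≤ (s≤s z≤n) (s≤s N≤n))) C/[1+N]<ε
  where
  den N : ℕ
  den = suc den-1
  N   = C * den
  C/[1+N]<ε : ι C ℚ.* 1/ι (suc N) ℚ.< ε
  C/[1+N]<ε = subst₂ ℚ._<_ (fromℚᵘ-homo-* (mkℚᵘ (+ C) 0) (mkℚᵘ (+ 1) N)) (ℚP.↥p/↧p≡p ε)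
    (fromℚᵘ-mono-< (mkℚᵘ (+ C) 0 ℚᵘ.* mkℚᵘ (+ 1) N) (mkℚᵘ (+ suc k) den-1)
      (ℚᵘ.*<* (subst₂ ℤ._<_ (trans (ℤP.pos-* (C * 1) den) (cong (ℤ._* + den) (ℤP.pos-* C 1))) (ℤP.pos-* (suc k) (1 * suc N))
        (ℤ.+<+ C*den<[1+k][1+N]))))
    where
    C*den<[1+k][1+N] : C * 1 * den < suc k * (1 * suc N)
    C*den<[1+k][1+N] = begin-strict
      C * 1 * den      ≡⟨ cong (_* den) (*-identityʳ C) ⟩
      N                <⟨ n<1+n N ⟩
      suc N            ≡⟨ sym (*-identityˡ (suc N)) ⟩
      1 * suc N        ≤⟨ m≤n*m (1 * suc N) (suc k) ⟩
      suc k * (1 * suc N) ∎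
      where open ≤-Reasoning

seriesSum-of-bound : ∀ d h L C → (∀ N → ℚ.∣ partialSum d h N ℚ.- L ∣ ℚ.≤ ι C ℚ.* 1/ι (suc N)) → SeriesSumIs d h L
seriesSum-of-bound d h L C bound ε 0<ε with archimedean C ε 0<ε
... | N , small = N , λ n N≤n → ℚP.≤-<-trans (bound n) (small n N≤n)

lemma4 : (g : ℚ) → g ≢ 1ℚ → g ≢ 0ℚ → g ≢ - 1ℚ →
         (g₀ : ℚ) (h : ℕ) → 0ℚ Data.Rational.< g₀ → NotPerfectPower g₀ →
         (g ≡ g₀ ^ℚ h ⊎ g ≡ - (g₀ ^ℚ h)) →
         ((g₁ : ℚ) (h₁ : ℕ) → 0ℚ Data.Rational.< g₁ → NotPerfectPower g₁ →
           (g ≡ g₁ ^ℚ h₁ ⊎ g ≡ - (g₁ ^ℚ h₁)) → h₁ ≤ h) →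
         (d : ℕ) → 0 < d →
         SeriesSumIs d h (S d h)
lemma4 _ g≢1 _ _    _ zero _ _ (inj₁ g≡1)  _ _ _ = ⊥-elim (g≢1 g≡1)
lemma4 _ _   _ g≢-1 _ zero _ _ (inj₂ g≡-1) _ _ _ = ⊥-elim (g≢-1 g≡-1)
lemma4 _ _   _ _    _ h@(suc _) _ _ _ _ d 1≤d =
  seriesSum-of-bound d h (S d h) (2 ^ length (primeDivisors d)) (PartialSums.partialSum-S-bound d h 1≤d (s≤s z≤n))
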